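{- Define, for nonnegative integers $r$ and positive integers $k$, \[ f(r,k) = \sum_{j=0}^{\lfloor r/2\rfloor} \frac{r!}{(r-2j)!\,j!\,2^j}\, k^{r-j}. \] Let $\pi$ be a permutation of $[n]$ having exactly $c_k$ cycles of length $k$ for each $k=1,\dots,n$. Then the number of pairs $(\sigma,\tau)$ of involutions of $[n]$ with $\pi = \tau\circ\sigma$ is \[ F(\pi) = \prod_{k=1}^n f(c_k,k). \]
   Context: An involution is a permutation all of whose cycles have length $1$ or $2$. -}

module Defs where

open import Data.Nat using (ℕ; zero; suc; _+_; _*_; _∸_; _^_; _/_; _≤_; _<_; _≤?_; _!) renaming (_≟_ to _≟ℕ_)
open import Data.Nat.Properties using (m*n≢0; m^n≢0; _!≢0)

open import Data.Fin using (Fin; toℕ) renaming (_≤_ to _≤ᶠ_; _≤?_ to _≤ᶠ?_)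
open import Data.Fin.Properties using (all?; _≟_)
open import Data.Fin.Permutation using (Permutation′; _⟨$⟩ʳ_)
open import Data.List using (List; []; _∷_; length; filter; map; concatMap; allFin; upTo; cartesianProduct)
open import Data.Nat.ListAction using (sum; product)
open import Data.Product using (_×_; _,_; proj₁; proj₂)
open import Relation.Binary.PropositionalEquality using (_≡_; _≢_)
open import Relation.Nullary using (Dec; ¬_; ¬?)
open import Relation.Unary using (Decidable)
import Data.Vec.Functional as V
open import Relation.Nullary.Decidable using (_×-dec_; _→-dec_)

-- f(r,k) = Σ_{j=0}^{⌊r/2⌋} r! / ((r-2j)! j! 2^j) · k^(r-j)   (division is exact)
fTerm : ℕ → ℕ → ℕ → ℕ
fTerm r k j = (r ! / (((r ∸ 2 * j) !) * (j !) * (2 ^ j))) {{nz}} * k ^ (r ∸ j)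
  where
  nz = m*n≢0 ((r ∸ 2 * j) ! * j !) (2 ^ j) {{m*n≢0 ((r ∸ 2 * j) !) (j !) {{(r ∸ 2 * j) !≢0}} {{j !≢0}}}} {{m^n≢0 2 j}}

f : ℕ → ℕ → ℕ
f r k = sum (map (fTerm r k) (upTo (suc (r / 2))))

iter : ∀ {n} → (Fin n → Fin n) → ℕ → Fin n → Fin n
iter g zero    i = i
iter g (suc m) i = g (iter g m i)

-- i is the smallest element of a cycle of π of length exactly k (k ≥ 1):
--   π^k(i) = i, π^m(i) = i only for m = 0 among 0 ≤ m < k, and
--   i ≤ π^m(i) for all m < k.
-- Each cycle of length k contains exactly one such element, so these
-- elements are in bijection with the cycles of length k.
IsCycleRep : ∀ {n} → Permutation′ n → ℕ → Fin n → Set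
IsCycleRep π k i =
  (iter (π ⟨$⟩ʳ_) k i ≡ i)
  × (∀ (m : Fin k) → iter (π ⟨$⟩ʳ_) (toℕ m) i ≡ i → toℕ m ≡ 0)
  × (∀ (m : Fin k) → i ≤ᶠ iter (π ⟨$⟩ʳ_) (toℕ m) i)

isCycleRep? : ∀ {n} (π : Permutation′ n) (k : ℕ) → Decidable (IsCycleRep π k)
isCycleRep? π k i =
  (iter (π ⟨$⟩ʳ_) k i ≟ i)
  ×-dec all? (λ m → (iter (π ⟨$⟩ʳ_) (toℕ m) i ≟ i) →-dec (toℕ m ≟ℕ 0))
  ×-dec all? (λ m → i ≤ᶠ? iter (π ⟨$⟩ʳ_) (toℕ m) i)

cycleCount : ∀ {n} → Permutation′ n → ℕ → ℕ
cycleCount {n} π k = length (filter (isCycleRep? π k) (allFin n))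

F : ∀ {n} → Permutation′ n → ℕ
F {n} π = product (map (λ k → f (cycleCount π k) k) (map suc (upTo n)))

-- list of all functions Fin m → Fin n (each exactly once, up to pointwise equality)
allFuns : ∀ m n → List (Fin m → Fin n)
allFuns zero    n = (λ ()) ∷ []
allFuns (suc m) n = concatMap (λ x → map (λ g → x V.∷ g) (allFuns m n)) (allFin n)

IsInvolution : ∀ {n} → (Fin n → Fin n) → Set
IsInvolution {n} σ = ∀ (i : Fin n) → σ (σ i) ≡ i

isInvolution? : ∀ {n} → Decidable (IsInvolution {n})
isInvolution? σ = all? (λ i → σ (σ i) ≟ i)

IsInvFactorization : ∀ {n} → Permutation′ n → (Fin n → Fin n) × (Fin n → Fin n) → Set
IsInvFactorization {n} π (σ , τ) =
  IsInvolution σ × IsInvolution τ × (∀ (i : Fin n) → π ⟨$⟩ʳ i ≡ τ (σ i))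

isInvFactorization? : ∀ {n} (π : Permutation′ n) → Decidable (IsInvFactorization π)
isInvFactorization? π (σ , τ) =
  isInvolution? σ ×-dec isInvolution? τ ×-dec all? (λ i → π ⟨$⟩ʳ i ≟ τ (σ i))

numInvFactorizations : ∀ {n} → Permutation′ n → ℕ
numInvFactorizations {n} π =
  length (filter (isInvFactorization? π) (cartesianProduct (allFuns n n) (allFuns n n)))

-- Writing π = τ ∘ σ with σ, τ involutions amounts to choosing an involution σ for which π ∘ σ is again
-- an involution, i.e. σ πᵃ x = π⁻ᵃ σ x: σ runs cycles of π backwards. So σ maps every cycle onto a cycle
-- of the same length and is determined on it by the image of a single point. Count such σ on a π-invariant
-- set U by induction on |U|: pick u on a k-cycle, with c_k cycles of length k in U. Either σ u is one of the
-- k points of its own cycle, or one of the (c_k − 1)k points on another k-cycle; removing the cycles involved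
-- leaves a smaller invariant set. This is the recurrence f(c, k) = k f(c − 1, k) + (c − 1) k f(c − 2, k),
-- which f satisfies because its coefficients count involutions with a given number of two-cycles.

module Submission where

open import Defs
open import Data.Nat using (ℕ)
open import Data.Fin.Permutation using (Permutation′)
open import Relation.Binary.PropositionalEquality using (_≡_; module ≡-Reasoning)

module Counting where

  open import Data.Nat using (ℕ; suc; _+_; _*_; _≤_; z≤n)
  open import Data.Nat.Properties using (+-assoc; *-zeroʳ; *-distribˡ-+; +-mono-≤; ≤-reflexive)
  open import Data.Nat.ListAction using (sum; product)
  open import Data.List using (List; []; _∷_; map; _++_; concat; concatMap; length; filter; cartesianProduct)
  open import Data.List.Properties using (map-cong; map-cong-local; filter-accept; filter-reject; filter-all)
  open import Data.List.Membership.Propositional using (_∈_)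
  open import Data.List.Relation.Unary.All as All using (All)
  open import Data.List.Relation.Unary.Any using (here; there)
  open import Data.List.Relation.Unary.Unique.Propositional using (Unique; _∷_)
  import Data.Nat.Properties as ℕ
  open import Algebra.Properties.CommutativeSemigroup ℕ.*-commutativeSemigroup using (x∙yz≈y∙xz)
  open import Algebra.Properties.CommutativeSemigroup ℕ.+-commutativeSemigroup using () renaming (interchange to +-interchange)
  open import Data.Product using (_×_; _,_)
  open import Data.Bool using (if_then_else_)
  open import Relation.Nullary using (yes; no; does; ¬_; contradiction)
  open import Relation.Nullary.Decidable using (_×-dec_; ¬?)
  open import Level using (0ℓ)
  open import Relation.Unary using (Pred; Decidable)
  open import Relation.Binary.Definitions using (DecidableEquality)
  open import Relation.Binary.PropositionalEquality
  open ≡-Reasoning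

  private
    variable
      A B : Set

  sum-map-cong : (L : List A) {f g : A → ℕ} → (∀ x → f x ≡ g x) → sum (map f L) ≡ sum (map g L)
  sum-map-cong L f≗g = cong sum (map-cong f≗g L)

  sum-map-zero : (L : List A) (f : A → ℕ) → (∀ x → f x ≡ 0) → sum (map f L) ≡ 0
  sum-map-zero []      f f≗0 = refl
  sum-map-zero (x ∷ L) f f≗0 rewrite f≗0 x = sum-map-zero L f f≗0

  sum-map-+ : (L : List A) (f g : A → ℕ) → sum (map (λ x → f x + g x) L) ≡ sum (map f L) + sum (map g L)
  sum-map-+ []      f g = refl
  sum-map-+ (x ∷ L) f g rewrite sum-map-+ L f g = +-interchange (f x) (g x) (sum (map f L)) (sum (map g L))

  sum-map-* : (L : List A) (c : ℕ) (f : A → ℕ) → sum (map (λ x → c * f x) L) ≡ c * sum (map f L)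
  sum-map-* []      c f = sym (*-zeroʳ c)
  sum-map-* (x ∷ L) c f rewrite sum-map-* L c f = sym (*-distribˡ-+ c (f x) _)

  sum-map-++ : (L M : List A) (f : A → ℕ) → sum (map f (L ++ M)) ≡ sum (map f L) + sum (map f M)
  sum-map-++ []      M f = refl
  sum-map-++ (x ∷ L) M f rewrite sum-map-++ L M f = sym (+-assoc (f x) _ _)

  sum-map-map : (L : List A) (h : A → B) (f : B → ℕ) → sum (map f (map h L)) ≡ sum (map (λ x → f (h x)) L)
  sum-map-map []      h f = refl
  sum-map-map (x ∷ L) h f = cong (f (h x) +_) (sum-map-map L h f)

  sum-map-concatMap : (L : List A) (h : A → List B) (f : B → ℕ) →
                      sum (map f (concatMap h L)) ≡ sum (map (λ x → sum (map f (h x))) L)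
  sum-map-concatMap []      h f = refl
  sum-map-concatMap (x ∷ L) h f =
    trans (sum-map-++ (h x) (concat (map h L)) f) (cong (sum (map f (h x)) +_) (sum-map-concatMap L h f))

  sum-map-swap : (L : List A) (M : List B) (h : A → B → ℕ) →
                 sum (map (λ a → sum (map (h a) M)) L) ≡ sum (map (λ b → sum (map (λ a → h a b) L)) M)
  sum-map-swap []      M h = sym (sum-map-zero M _ (λ _ → refl))
  sum-map-swap (x ∷ L) M h =
    trans (cong (sum (map (h x) M) +_) (sum-map-swap L M h)) (sym (sum-map-+ M (h x) _))

  indicator : {P : Pred A 0ℓ} → Decidable P → A → ℕ
  indicator P? x = if does (P? x) then 1 else 0

  indicator-yes : {P : Pred A 0ℓ} (P? : Decidable P) {x : A} → P x → indicator P? x ≡ 1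
  indicator-yes P? {x} px with P? x
  ... | yes _   = refl
  ... | no ¬px = contradiction px ¬px

  indicator-no : {P : Pred A 0ℓ} (P? : Decidable P) {x : A} → ¬ P x → indicator P? x ≡ 0
  indicator-no P? {x} ¬px with P? x
  ... | yes px = contradiction px ¬px
  ... | no  _  = refl

  indicator-cong : {P Q : Pred A 0ℓ} (P? : Decidable P) (Q? : Decidable Q) (x : A) →
                   (P x → Q x) → (Q x → P x) → indicator P? x ≡ indicator Q? x
  indicator-cong P? Q? x p⇒q q⇒p with P? x
  ... | yes px  = sym (indicator-yes Q? (p⇒q px))
  ... | no  ¬px = sym (indicator-no Q? (λ qx → ¬px (q⇒p qx)))

  count : {P : Pred A 0ℓ} → Decidable P → List A → ℕ
  count P? L = sum (map (indicator P?) L)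

  length-filter : {P : Pred A 0ℓ} (P? : Decidable P) (L : List A) → length (filter P? L) ≡ count P? L
  length-filter P? []      = refl
  length-filter P? (x ∷ L) with P? x
  ... | yes _ = cong suc (length-filter P? L)
  ... | no  _ = length-filter P? L

  count-cong : {P Q : Pred A 0ℓ} (P? : Decidable P) (Q? : Decidable Q) (L : List A) →
               (∀ x → P x → Q x) → (∀ x → Q x → P x) → count P? L ≡ count Q? L
  count-cong P? Q? L p⇒q q⇒p = sum-map-cong L (λ x → indicator-cong P? Q? x (p⇒q x) (q⇒p x))

  count-none : {P : Pred A 0ℓ} (P? : Decidable P) (L : List A) → (∀ x → ¬ P x) → count P? L ≡ 0
  count-none P? L ¬p = sum-map-zero L _ (λ x → indicator-no P? (¬p x))

  count-all : {P : Pred A 0ℓ} (P? : Decidable P) (L : List A) → (∀ x → P x) → count P? L ≡ length L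
  count-all P? []      p = refl
  count-all P? (x ∷ L) p = cong₂ _+_ (indicator-yes P? (p x)) (count-all P? L p)

  count-mono : {P Q : Pred A 0ℓ} (P? : Decidable P) (Q? : Decidable Q) (L : List A) →
               (∀ x → P x → Q x) → count P? L ≤ count Q? L
  count-mono P? Q? []      p⇒q = z≤n
  count-mono P? Q? (x ∷ L) p⇒q = +-mono-≤ indicator-mono (count-mono P? Q? L p⇒q)
    where
    indicator-mono : indicator P? x ≤ indicator Q? x
    indicator-mono with P? x
    ... | yes px = ≤-reflexive (sym (indicator-yes Q? (p⇒q x px)))
    ... | no  _  = z≤n

  count-split : {P Q : Pred A 0ℓ} (P? : Decidable P) (Q? : Decidable Q) (L : List A) →
                count P? L ≡ count (λ x → P? x ×-dec Q? x) L + count (λ x → P? x ×-dec ¬? (Q? x)) L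
  count-split {P = P} {Q = Q} P? Q? L = trans (sum-map-cong L split) (sum-map-+ L _ _)
    where
    split : ∀ x → indicator P? x ≡ indicator (λ x → P? x ×-dec Q? x) x + indicator (λ x → P? x ×-dec ¬? (Q? x)) x
    split x with P? x | Q? x
    ... | yes _ | yes _ = refl
    ... | yes _ | no  _ = refl
    ... | no  _ | _     = refl

  count-map : {P : Pred B 0ℓ} (P? : Decidable P) (h : A → B) (L : List A) → count P? (map h L) ≡ count (λ x → P? (h x)) L
  count-map P? h L = sum-map-map L h (indicator P?)

  count-cartesianProduct : {R : Pred (A × B) 0ℓ} (R? : Decidable R) (L : List A) (M : List B) →
                           count R? (cartesianProduct L M) ≡ sum (map (λ a → count (λ b → R? (a , b)) M) L)
  count-cartesianProduct R? []      M = refl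
  count-cartesianProduct R? (x ∷ L) M =
    trans (sum-map-++ (map (x ,_) M) _ (indicator R?)) (cong₂ _+_ (count-map R? (x ,_) M) (count-cartesianProduct R? L M))

  record IsEnumeration (_≟_ : DecidableEquality A) (L : List A) : Set where
    constructor occurs-once
    field
      count-≟ : ∀ x → count (_≟ x) L ≡ 1

  open IsEnumeration public

  module _ {_≟_ : DecidableEquality A} {L : List A} (enum : IsEnumeration _≟_ L) where

    count-unique : {P : Pred A 0ℓ} (P? : Decidable P) (a : A) → P a → (∀ x → P x → x ≡ a) → count P? L ≡ 1
    count-unique P? a pa unique =
      trans (count-cong P? (_≟ a) L unique (λ x x≡a → subst _ (sym x≡a) pa)) (count-≟ enum a)

    count-≟-indicator : {P : Pred A 0ℓ} (P? : Decidable P) (b : A) → count (λ a → P? a ×-dec (b ≟ a)) L ≡ indicator P? b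
    count-≟-indicator P? b with P? b
    ... | yes p = count-unique (λ a → P? a ×-dec (b ≟ a)) b (p , refl) (λ _ (_ , e) → sym e)
    ... | no ¬p = count-none (λ a → P? a ×-dec (b ≟ a)) L (λ { _ (p , refl) → ¬p p })

  module _ {_≟_ : DecidableEquality B} {V : List B} (enum : IsEnumeration _≟_ V) where

    count-fibres : {P : Pred A 0ℓ} (P? : Decidable P) (g : A → B) (L : List A) →
                   count P? L ≡ sum (map (λ v → count (λ a → P? a ×-dec (g a ≟ v)) L) V)
    count-fibres P? g L = trans (sum-map-cong L fibre) (sum-map-swap L V (λ a v → indicator (λ a → P? a ×-dec (g a ≟ v)) a))
      where
      fibre : ∀ a → indicator P? a ≡ sum (map (λ v → indicator (λ a → P? a ×-dec (g a ≟ v)) a) V)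
      fibre a = sym (count-≟-indicator enum (λ _ → P? a) (g a))

  module _ {_≟A_ : DecidableEquality A} {_≟B_ : DecidableEquality B} {L : List A} {M : List B}
           (enumL : IsEnumeration _≟A_ L) (enumM : IsEnumeration _≟B_ M) where

    count-bijection : {P : Pred A 0ℓ} {Q : Pred B 0ℓ} (P? : Decidable P) (Q? : Decidable Q) (Φ : A → B) (Ψ : B → A) →
                      (∀ a → P a → Q (Φ a)) → (∀ b → Q b → P (Ψ b)) →
                      (∀ a → P a → Ψ (Φ a) ≡ a) → (∀ b → Q b → Φ (Ψ b) ≡ b) →
                      count P? L ≡ count Q? M
    count-bijection {Q = Q} P? Q? Φ Ψ p⇒q q⇒p ΨΦ ΦΨ = trans (count-fibres enumM P? Φ L) (sum-map-cong M fibre)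
      where
      fibre : ∀ b → count (λ a → P? a ×-dec (Φ a ≟B b)) L ≡ indicator Q? b
      fibre b with Q? b
      ... | yes q = count-unique enumL (λ a → P? a ×-dec (Φ a ≟B b)) (Ψ b) (q⇒p b q , ΦΨ b q)
                      (λ a (p , e) → trans (sym (ΨΦ a p)) (cong Ψ e))
      ... | no ¬q = count-none (λ a → P? a ×-dec (Φ a ≟B b)) L (λ a (p , e) → ¬q (subst Q e (p⇒q a p)))

  product-factor : ∀ {L} → Unique L → ∀ {k} → k ∈ L → (h : ℕ → ℕ) →
                   product (map h L) ≡ h k * product (map h (filter (λ j → ¬? (j ℕ.≟ k)) L))
  product-factor {x ∷ L} (x∉L ∷ unique) (here refl) h =
    cong (λ M → h x * product (map h M))
         (sym (trans (filter-reject (λ j → ¬? (j ℕ.≟ x)) (λ x≢x → x≢x refl))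
                     (filter-all (λ j → ¬? (j ℕ.≟ x)) (All.map (λ x≢j j≡x → x≢j (sym j≡x)) x∉L))))
  product-factor {x ∷ L} (x∉L ∷ unique) {k} (there k∈L) h = begin
    h x * product (map h L)                               ≡⟨ cong (h x *_) (product-factor unique k∈L h) ⟩
    h x * (h k * product (map h L≢k))                     ≡⟨ x∙yz≈y∙xz (h x) (h k) _ ⟩
    h k * (h x * product (map h L≢k))
      ≡⟨ cong (λ M → h k * product (map h M)) (sym (filter-accept (λ j → ¬? (j ℕ.≟ k)) x≢k)) ⟩
    h k * product (map h (filter (λ j → ¬? (j ℕ.≟ k)) (x ∷ L))) ∎
    where
    L≢k : List ℕ
    L≢k = filter (λ j → ¬? (j ℕ.≟ k)) L
    x≢k : x ≢ k
    x≢k = All.lookup x∉L k∈L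

  product-cong : ∀ L {h h′ : ℕ → ℕ} → (∀ {j} → j ∈ L → h j ≡ h′ j) → product (map h L) ≡ product (map h′ L)
  product-cong L h≗h′ = cong product (map-cong-local (All.tabulate h≗h′))

  product-map-≡1 : ∀ L {h : ℕ → ℕ} → (∀ j → h j ≡ 1) → product (map h L) ≡ 1
  product-map-≡1 []      h≡1 = refl
  product-map-≡1 (x ∷ L) h≡1 rewrite h≡1 x = trans (ℕ.+-identityʳ _) (product-map-≡1 L h≡1)

module Finite where

  open import Data.Nat.ListAction using (sum)
  open Counting
  open import Data.Nat using (ℕ; zero; suc; z≤n; s≤s)
  open import Data.Fin using (Fin; zero; suc) renaming (_≤_ to _≤ᶠ_)
  open import Data.Fin.Properties using (_≟_)
  open import Data.List using (List; _∷_; map; allFin)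
  import Data.Vec.Functional as Fun
  open import Data.List.Properties using (map-tabulate)
  open import Data.Product using (Σ; _×_; _,_)
  open import Data.Vec using (Vec; []; _∷_; tabulate; lookup)
  import Data.Vec.Properties as Vec
  open import Relation.Nullary using (Dec; yes; no; contradiction)
  open import Relation.Unary using (Pred; Decidable)
  open import Level using (0ℓ)
  open import Relation.Binary.Definitions using (DecidableEquality)
  open import Relation.Binary.PropositionalEquality

  allFin-isEnumeration : ∀ n → IsEnumeration _≟_ (allFin n)
  allFin-isEnumeration n = occurs-once (once n)
    where
    once : ∀ n (x : Fin n) → count (_≟ x) (allFin n) ≡ 1
    once (suc n) x = trans (cong (λ L → count (_≟ x) (zero ∷ L)) (sym (map-tabulate (λ i → i) suc))) (once-suc x)
      where
      once-suc : ∀ x → count (_≟ x) (zero ∷ map suc (allFin n)) ≡ 1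
      once-suc zero    = cong suc (trans (count-map (_≟ zero) suc (allFin n)) (count-none (λ y → suc y ≟ zero) (allFin n) (λ _ ())))
      once-suc (suc x) = trans (count-map (_≟ suc x) suc (allFin n)) (once n x)

  allVecs : ∀ m n → List (Vec (Fin n) m)
  allVecs m n = map tabulate (allFuns m n)

  _≟ᵥ_ : ∀ {m n} → DecidableEquality (Vec (Fin n) m)
  _≟ᵥ_ = Vec.≡-dec _≟_

  allVecs-isEnumeration : ∀ m n → IsEnumeration _≟ᵥ_ (allVecs m n)
  allVecs-isEnumeration m n = occurs-once (λ w → trans (count-map (_≟ᵥ w) tabulate (allFuns m n)) (once m w))
    where
    once : ∀ m (w : Vec (Fin n) m) → count (λ g → tabulate g ≟ᵥ w) (allFuns m n) ≡ 1
    once zero    []      = refl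
    once (suc m) (y ∷ w) = begin
      count (λ g → tabulate g ≟ᵥ (y ∷ w)) (allFuns (suc m) n)
        ≡⟨ sum-map-concatMap (allFin n) (λ x → map (x Fun.∷_) (allFuns m n)) _ ⟩
      sum (map (λ x → count (λ g → tabulate g ≟ᵥ (y ∷ w)) (map (x Fun.∷_) (allFuns m n))) (allFin n))
        ≡⟨ sum-map-cong (allFin n) fibre ⟩
      count (_≟ y) (allFin n)
        ≡⟨ count-≟ (allFin-isEnumeration n) y ⟩
      1 ∎
      where
      open ≡-Reasoning
      fibre : ∀ x → count (λ g → tabulate g ≟ᵥ (y ∷ w)) (map (x Fun.∷_) (allFuns m n)) ≡ indicator (_≟ y) x
      fibre x = trans (count-map (λ g → tabulate g ≟ᵥ (y ∷ w)) (x Fun.∷_) (allFuns m n)) (fibre′ (x ≟ y))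
        where
        fibre′ : Dec (x ≡ y) → count (λ g → (x ∷ tabulate g) ≟ᵥ (y ∷ w)) (allFuns m n) ≡ indicator (_≟ y) x
        fibre′ (yes refl) = trans (count-cong (λ g → (x ∷ tabulate g) ≟ᵥ (x ∷ w)) (λ g → tabulate g ≟ᵥ w) (allFuns m n)
                                              (λ _ → Vec.∷-injectiveʳ) (λ _ → cong (x ∷_)))
                                  (trans (once m w) (sym (indicator-yes (_≟ y) refl)))
        fibre′ (no x≢y)   = trans (count-none (λ g → (x ∷ tabulate g) ≟ᵥ (y ∷ w)) (allFuns m n)
                                              (λ _ e → x≢y (Vec.∷-injectiveˡ e)))
                                  (sym (indicator-no (_≟ y) x≢y))

  module _ {m n : ℕ} {P : Pred (Fin m → Fin n) 0ℓ} (P? : Decidable P) where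

    count-allFuns : (∀ f g → f ≗ g → P f → P g) → count P? (allFuns m n) ≡ count (λ w → P? (lookup w)) (allVecs m n)
    count-allFuns resp = sym (trans (count-map (λ w → P? (lookup w)) tabulate (allFuns m n))
                                    (count-cong (λ f → P? (lookup (tabulate f))) P? (allFuns m n)
                                                (λ f → resp _ f (Vec.lookup∘tabulate f))
                                                                   (λ f → resp f _ (λ i → sym (Vec.lookup∘tabulate f i)))))

  leastWitness : ∀ {m} {P : Pred (Fin m) 0ℓ} → Decidable P → ∀ a → P a → Σ (Fin m) λ y → P y × (∀ z → P z → y ≤ᶠ z)
  leastWitness {suc m} {P} P? a pa with P? zero
  ... | yes p0 = zero , p0 , λ _ _ → z≤n
  ... | no ¬p0 with a
  ...   | zero   = contradiction pa ¬p0
  ...   | suc a′ with leastWitness (λ i → P? (suc i)) a′ pa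
  ...     | y , py , least = suc y , py , least′
    where
    least′ : ∀ z → P z → suc y ≤ᶠ z
    least′ zero    pz = contradiction pz ¬p0
    least′ (suc z) pz = s≤s (least z pz)

module Recurrence where

  open import Data.Nat using (ℕ; zero; suc; _+_; _*_; _∸_; _^_; _≤_; _<_; z≤n; s≤s; z<s; s<s; _/_; _!; NonZero)
  open import Data.Nat.Properties
    using (+-identityʳ; *-identityʳ; *-identityˡ; *-zeroʳ; <-trans; n<1+n; ≤-pred; ≤-trans; m≤n*m; *-monoʳ-≤; *-comm; ≰⇒>; <⇒≱;
           m*n≢0; m^n≢0; _!≢0; m∸n+n≡m; m+[n∸m]≡n; ≤-<-connex; +-∸-assoc; +-assoc; *-distribˡ-+; +-comm; +-commutativeSemigroup)
  open import Data.Nat.DivMod using (m*n/n≡m; m/n*n≤m; m/n≤m; /-monoˡ-≤)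
  open import Data.Nat.ListAction using (sum)
  open import Data.Nat.Tactic.RingSolver using (solve-∀)
  open import Algebra.Properties.CommutativeSemigroup +-commutativeSemigroup using () renaming (interchange to +-interchange)
  open import Data.List using (map; applyUpTo)
  open import Data.Sum using (inj₁; inj₂)
  open import Relation.Binary.PropositionalEquality

  -- matchings r j = r! / ((r − 2j)! j! 2ʲ) counts the involutions of an r-set with j two-cycles;
  -- in the recursion the last point is either fixed or paired with one of the other r + 1.
  matchings : ℕ → ℕ → ℕ
  matchings r             zero    = 1
  matchings zero          (suc j) = 0
  matchings (suc zero)    (suc j) = 0
  matchings (suc (suc r)) (suc j) = matchings (suc r) (suc j) + suc r * matchings r j

  2*suc : ∀ j → 2 * suc j ≡ suc (suc (2 * j))
  2*suc = solve-∀

  +2-mono-<2* : ∀ {r j} → r < 2 * j → 2 + r < 2 * suc j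
  +2-mono-<2* {r} {j} r<2j = subst (2 + r <_) (sym (2*suc j)) (s<s (s<s r<2j))

  <⇒<2* : ∀ {r j} → r < j → r < 2 * j
  <⇒<2* {r} {j} r<j = ≤-trans r<j (m≤n*m j 2)

  matchings-zero : ∀ r j → r < 2 * j → matchings r j ≡ 0
  matchings-zero r             zero    ()
  matchings-zero zero          (suc j) _ = refl
  matchings-zero (suc zero)    (suc j) _ = refl
  matchings-zero (suc (suc r)) (suc j) r+2<2j+2 =
    cong₂ _+_ (matchings-zero (suc r) (suc j) (<-trans (n<1+n _) r+2<2j+2))
              (trans (cong (suc r *_) (matchings-zero r j r<2j)) (*-zeroʳ (suc r)))
    where
    r<2j : r < 2 * j
    r<2j = ≤-pred (≤-pred (subst (2 + r <_) (2*suc j) r+2<2j+2))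

  m+2*suc : ∀ m j → m + 2 * suc j ≡ suc (suc (m + 2 * j))
  m+2*suc = solve-∀

  matchings-factorial : ∀ j m → matchings (m + 2 * j) j * (m ! * j ! * 2 ^ j) ≡ (m + 2 * j) !
  matchings-factorial zero m rewrite +-identityʳ m = trans (+-identityʳ _) (trans (*-identityʳ (m ! * 1)) (*-identityʳ (m !)))
  matchings-factorial (suc j) zero =
    subst (λ r → matchings r (suc j) * (1 * (suc j * j !) * (2 * 2 ^ j)) ≡ r !) (sym (2*suc j)) (begin
      (matchings (suc (2 * j)) (suc j) + suc (2 * j) * Y) * (1 * (suc j * j !) * (2 * 2 ^ j))
        ≡⟨ cong (λ X → (X + suc (2 * j) * Y) * (1 * (suc j * j !) * (2 * 2 ^ j)))
                (matchings-zero (suc (2 * j)) (suc j) (subst (suc (2 * j) <_) (sym (2*suc j)) (n<1+n _))) ⟩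
      (0 + suc (2 * j) * Y) * (1 * (suc j * j !) * (2 * 2 ^ j))
        ≡⟨ rearrange j Y (j !) (2 ^ j) ⟩
      (2 + 2 * j) * ((1 + 2 * j) * (Y * (1 * j ! * 2 ^ j)))
        ≡⟨ cong (λ z → (2 + 2 * j) * ((1 + 2 * j) * z)) (matchings-factorial j 0) ⟩
      (2 + 2 * j) * ((1 + 2 * j) * (2 * j) !) ∎)
    where
    open ≡-Reasoning
    Y : ℕ
    Y = matchings (2 * j) j
    rearrange : ∀ j Y a b → (0 + suc (2 * j) * Y) * (1 * (suc j * a) * (2 * b)) ≡ (2 + 2 * j) * ((1 + 2 * j) * (Y * (1 * a * b)))
    rearrange = solve-∀
  matchings-factorial (suc j) (suc m) =
    subst (λ r → matchings r (suc j) * (suc m ! * (suc j * j !) * (2 * 2 ^ j)) ≡ r !) (sym (m+2*suc (suc m) j)) (begin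
      (X + suc (suc t) * Y) * (suc m ! * (suc j * j !) * (2 * 2 ^ j))
        ≡⟨ rearrange m j X Y (m !) (j !) (2 ^ j) t ⟩
      suc m * (X * (m ! * (suc j * j !) * (2 * 2 ^ j))) + (2 + t) * (2 * suc j) * (Y * (suc m ! * j ! * 2 ^ j))
        ≡⟨ cong₂ (λ a b → suc m * a + (2 + t) * (2 * suc j) * b) IH₁ (matchings-factorial j (suc m)) ⟩
      suc m * ((2 + t) * ((1 + t) * t !)) + (2 + t) * (2 * suc j) * ((1 + t) * t !)
        ≡⟨ collect m j (t !) ⟩
      (3 + t) * ((2 + t) * ((1 + t) * t !)) ∎)
    where
    open ≡-Reasoning
    t X Y : ℕ
    t = m + 2 * j
    X = matchings (suc (suc t)) (suc j)
    Y = matchings (suc t) j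
    IH₁ : X * (m ! * (suc j * j !) * (2 * 2 ^ j)) ≡ (2 + t) * ((1 + t) * t !)
    IH₁ = subst (λ r → matchings r (suc j) * (m ! * (suc j * j !) * (2 * 2 ^ j)) ≡ r !) (m+2*suc m j) (matchings-factorial (suc j) m)
    rearrange : ∀ m j X Y a b c t → (X + (2 + t) * Y) * (suc m * a * (suc j * b) * (2 * c)) ≡
                suc m * (X * (a * (suc j * b) * (2 * c))) + (2 + t) * (2 * suc j) * (Y * (suc m * a * b * c))
    rearrange = solve-∀
    collect : ∀ m j F → suc m * ((2 + (m + 2 * j)) * ((1 + (m + 2 * j)) * F)) + (2 + (m + 2 * j)) * (2 * suc j) * ((1 + (m + 2 * j)) * F)
              ≡ (3 + (m + 2 * j)) * ((2 + (m + 2 * j)) * ((1 + (m + 2 * j)) * F))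
    collect = solve-∀

  ∑< : ℕ → (ℕ → ℕ) → ℕ
  ∑< zero    g = 0
  ∑< (suc M) g = g 0 + ∑< M (λ j → g (suc j))

  sum-applyUpTo : ∀ (g h : ℕ → ℕ) M → sum (map g (applyUpTo h M)) ≡ ∑< M (λ j → g (h j))
  sum-applyUpTo g h zero    = refl
  sum-applyUpTo g h (suc M) = cong (g (h 0) +_) (sum-applyUpTo g (λ j → h (suc j)) M)

  ∑<-cong : ∀ M {g g′} → (∀ j → j < M → g j ≡ g′ j) → ∑< M g ≡ ∑< M g′
  ∑<-cong zero    e = refl
  ∑<-cong (suc M) e = cong₂ _+_ (e 0 z<s) (∑<-cong M (λ j j<M → e (suc j) (s<s j<M)))

  ∑<-+ : ∀ M g h → ∑< M (λ j → g j + h j) ≡ ∑< M g + ∑< M h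
  ∑<-+ zero    g h = refl
  ∑<-+ (suc M) g h rewrite ∑<-+ M (λ j → g (suc j)) (λ j → h (suc j)) = +-interchange (g 0) (h 0) _ _

  ∑<-* : ∀ M c g → ∑< M (λ j → c * g j) ≡ c * ∑< M g
  ∑<-* zero    c g = sym (*-zeroʳ c)
  ∑<-* (suc M) c g rewrite ∑<-* M c (λ j → g (suc j)) = sym (*-distribˡ-+ c (g 0) _)

  ∑<-zeros : ∀ M g → (∀ j → g j ≡ 0) → ∑< M g ≡ 0
  ∑<-zeros zero    g e = refl
  ∑<-zeros (suc M) g e rewrite e 0 = ∑<-zeros M (λ j → g (suc j)) (λ j → e (suc j))

  ∑<-extend : ∀ M d g → (∀ j → M ≤ j → g j ≡ 0) → ∑< (M + d) g ≡ ∑< M g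
  ∑<-extend zero    d g e = ∑<-zeros d g (λ j → e j z≤n)
  ∑<-extend (suc M) d g e = cong (g 0 +_) (∑<-extend M d (λ j → g (suc j)) (λ j M≤j → e (suc j) (s≤s M≤j)))

  2*≤half : ∀ {j r} → j ≤ r / 2 → 2 * j ≤ r
  2*≤half {j} {r} j≤r/2 = ≤-trans (*-monoʳ-≤ 2 j≤r/2) (subst (_≤ r) (*-comm (r / 2) 2) (m/n*n≤m r 2))

  half<⇒<2* : ∀ {j r} → r / 2 < j → r < 2 * j
  half<⇒<2* {j} {r} r/2<j = ≰⇒> λ 2j≤r →
    <⇒≱ r/2<j (subst (_≤ r / 2) (trans (cong (_/ 2) (*-comm 2 j)) (m*n/n≡m j 2)) (/-monoˡ-≤ 2 2j≤r))

  module _ (k : ℕ) where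

    term : ℕ → ℕ → ℕ
    term r j = matchings r j * k ^ (r ∸ j)

    term-zero : ∀ r j → r < 2 * j → term r j ≡ 0
    term-zero r j r<2j = cong (_* k ^ (r ∸ j)) (matchings-zero r j r<2j)

    fTerm≡term : ∀ r j → 2 * j ≤ r → fTerm r k j ≡ term r j
    fTerm≡term r j 2j≤r =
      cong (_* k ^ (r ∸ j)) (trans (cong (λ z → (z / D) {{D≢0}}) (sym product≡r!)) (m*n/n≡m (matchings r j) D {{D≢0}}))
      where
      D : ℕ
      D = (r ∸ 2 * j) ! * j ! * 2 ^ j
      D≢0 : NonZero D
      D≢0 = m*n≢0 ((r ∸ 2 * j) ! * j !) (2 ^ j) {{m*n≢0 ((r ∸ 2 * j) !) (j !) {{(r ∸ 2 * j) !≢0}} {{j !≢0}}}} {{m^n≢0 2 j}}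
      product≡r! : matchings r j * D ≡ r !
      product≡r! = subst (λ s → matchings s j * D ≡ s !) (m∸n+n≡m 2j≤r) (matchings-factorial j (r ∸ 2 * j))

    -- Summing j up to r instead of ⌊r/2⌋ only adds zero terms.
    f≡∑term : ∀ r → f r k ≡ ∑< (suc r) (term r)
    f≡∑term r = begin
      f r k                              ≡⟨ sum-applyUpTo (fTerm r k) (λ j → j) (suc (r / 2)) ⟩
      ∑< (suc (r / 2)) (fTerm r k)
        ≡⟨ ∑<-cong (suc (r / 2)) (λ j j≤r/2 → fTerm≡term r j (2*≤half (≤-pred j≤r/2))) ⟩
      ∑< (suc (r / 2)) (term r)
        ≡⟨ sym (∑<-extend (suc (r / 2)) (r ∸ r / 2) (term r) (λ j r/2<j → term-zero r j (half<⇒<2* r/2<j))) ⟩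
      ∑< (suc (r / 2) + (r ∸ r / 2)) (term r) ≡⟨ cong (λ M → ∑< (suc M) (term r)) (m+[n∸m]≡n (m/n≤m r 2)) ⟩
      ∑< (suc r) (term r) ∎
      where
      open ≡-Reasoning

    term-step : ∀ r j → term (suc (suc r)) (suc j) ≡ k * term (suc r) (suc j) + suc r * k * term r j
    term-step r j with ≤-<-connex j r
    ... | inj₁ j≤r = trans (cong (λ e → (matchings (suc r) (suc j) + suc r * matchings r j) * k ^ e) (+-∸-assoc 1 j≤r))
                           (distribute (matchings (suc r) (suc j)) (matchings r j) (suc r) k (k ^ (r ∸ j)))
      where
      distribute : ∀ a b s k x → (a + s * b) * (k * x) ≡ k * (a * x) + s * k * (b * x)
      distribute = solve-∀
    ... | inj₂ r<j rewrite term-zero (2 + r) (suc j) (+2-mono-<2* (<⇒<2* r<j))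
                        | term-zero (1 + r) (suc j) (<-trans (n<1+n _) (+2-mono-<2* (<⇒<2* r<j)))
                        | term-zero r j (<⇒<2* r<j)
                        = sym (cong₂ _+_ (*-zeroʳ k) (*-zeroʳ (suc r * k)))

    ∑term-recurrence : ∀ r → ∑< (3 + r) (term (2 + r)) ≡ k * ∑< (2 + r) (term (1 + r)) + suc r * k * ∑< (1 + r) (term r)
    ∑term-recurrence r = begin
      term (2 + r) 0 + ∑< (2 + r) (λ j → term (2 + r) (suc j))
        ≡⟨ cong₂ _+_ shift (∑<-cong (2 + r) (λ j _ → term-step r j)) ⟩
      k * term (1 + r) 0 + ∑< (2 + r) (λ j → k * term (1 + r) (suc j) + suc r * k * term r j)
        ≡⟨ cong (k * term (1 + r) 0 +_) (∑<-+ (2 + r) (λ j → k * term (1 + r) (suc j)) (λ j → suc r * k * term r j)) ⟩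
      k * term (1 + r) 0 + (∑< (2 + r) (λ j → k * term (1 + r) (suc j)) + ∑< (2 + r) (λ j → suc r * k * term r j))
        ≡⟨ cong (k * term (1 + r) 0 +_) (cong₂ _+_ (∑<-* (2 + r) k (λ j → term (1 + r) (suc j))) (∑<-* (2 + r) (suc r * k) (term r))) ⟩
      k * term (1 + r) 0 + (k * ∑< (2 + r) (λ j → term (1 + r) (suc j)) + suc r * k * ∑< (2 + r) (term r))
        ≡⟨ sym (+-assoc (k * term (1 + r) 0) _ _) ⟩
      k * term (1 + r) 0 + k * ∑< (2 + r) (λ j → term (1 + r) (suc j)) + suc r * k * ∑< (2 + r) (term r)
        ≡⟨ cong₂ _+_ (sym (*-distribˡ-+ k (term (1 + r) 0) _)) (cong (suc r * k *_) (drop-last r)) ⟩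
      k * ∑< (3 + r) (term (1 + r)) + suc r * k * ∑< (1 + r) (term r)
        ≡⟨ cong (λ z → k * z + suc r * k * ∑< (1 + r) (term r)) (drop-last (1 + r)) ⟩
      k * ∑< (2 + r) (term (1 + r)) + suc r * k * ∑< (1 + r) (term r) ∎
      where
      open ≡-Reasoning
      shift : 1 * (k * k ^ suc r) ≡ k * (1 * k ^ suc r)
      shift = trans (*-identityˡ _) (cong (k *_) (sym (*-identityˡ _)))
      drop-last : ∀ r → ∑< (2 + r) (term r) ≡ ∑< (1 + r) (term r)
      drop-last r = trans (cong (λ M → ∑< M (term r)) (+-comm 1 (suc r)))
                          (∑<-extend (suc r) 1 (term r) (λ j r<j → term-zero r j (<⇒<2* r<j)))

    f-recurrence : ∀ c → 0 < c → f c k ≡ k * f (c ∸ 1) k + (c ∸ 1) * k * f (c ∸ 2) k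
    f-recurrence (suc zero)    _ = trans (f≡∑term 1) (+-identityʳ _)
    f-recurrence (suc (suc r)) _ = begin
      f (2 + r) k
        ≡⟨ f≡∑term (2 + r) ⟩
      ∑< (3 + r) (term (2 + r))
        ≡⟨ ∑term-recurrence r ⟩
      k * ∑< (2 + r) (term (1 + r)) + suc r * k * ∑< (1 + r) (term r)
        ≡⟨ sym (cong₂ (λ a b → k * a + suc r * k * b) (f≡∑term (1 + r)) (f≡∑term r)) ⟩
      k * f (1 + r) k + suc r * k * f r k ∎
      where open ≡-Reasoning

module Orbits {n : ℕ} (π : Permutation′ n) where

  open Finite using (leastWitness)
  open import Data.Nat using (ℕ; zero; suc; _+_; _*_; _∸_; _≤_; _<_; _<?_; _%_; _/_; NonZero; >-nonZero)
  open import Data.Nat.Properties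
    using (+-comm; <-trans; *-suc; suc-pred; n<1+n; ≤-trans; ≤-pred; <⇒≤; <-irrefl; <-cmp; ≤-<-trans; m∸n≤m; m∸n+n≡m; m<n⇒0<n∸m)
  open import Data.Nat.DivMod using (m%n<n; m≡m%n+[m/n]*n)
  open import Data.Fin using (Fin; zero; suc; toℕ; fromℕ<)
  open import Data.Fin.Properties using (_≟_; toℕ<n; toℕ-fromℕ<; pigeonhole; any?)
  open import Data.Fin.Permutation using (Permutation′; _⟨$⟩ʳ_; _⟨$⟩ˡ_; inverseˡ)
  open import Data.Product using (Σ; _×_; _,_; proj₁; proj₂)
  open import Level using (0ℓ)
  open import Relation.Nullary using (contradiction)
  open import Relation.Nullary.Decidable using (_×-dec_)
  open import Relation.Unary using (Pred; Decidable)
  open import Relation.Binary.PropositionalEquality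
  open import Relation.Binary.Definitions using (tri<; tri≈; tri>)

  p : Fin n → Fin n
  p i = π ⟨$⟩ʳ i

  p-injective : ∀ {x y} → p x ≡ p y → x ≡ y
  p-injective {x} {y} e = trans (sym (inverseˡ π)) (trans (cong (π ⟨$⟩ˡ_) e) (inverseˡ π))

  iter-+ : ∀ a b x → iter p (a + b) x ≡ iter p a (iter p b x)
  iter-+ zero    b x = refl
  iter-+ (suc a) b x = cong p (iter-+ a b x)

  iter-injective : ∀ a {x y} → iter p a x ≡ iter p a y → x ≡ y
  iter-injective zero    e = e
  iter-injective (suc a) e = iter-injective a (p-injective e)

  iter-comm : ∀ a b x → iter p a (iter p b x) ≡ iter p b (iter p a x)
  iter-comm a b x = trans (sym (iter-+ a b x)) (trans (cong (λ m → iter p m x) (+-comm a b)) (iter-+ b a x))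

  iter-∸ : ∀ {a b} x → a ≤ b → iter p b x ≡ iter p (b ∸ a) (iter p a x)
  iter-∸ {a} {b} x a≤b = trans (cong (λ m → iter p m x) (sym (m∸n+n≡m a≤b))) (iter-+ (b ∸ a) a x)

  iter-* : ∀ k x → iter p k x ≡ x → ∀ c → iter p (c * k) x ≡ x
  iter-* k x e zero    = refl
  iter-* k x e (suc c) = trans (iter-+ k (c * k) x) (trans (cong (iter p k) (iter-* k x e c)) e)

  iter-% : ∀ k x → iter p k x ≡ x → .{{_ : NonZero k}} → ∀ m → iter p m x ≡ iter p (m % k) x
  iter-% k x e m = trans (cong (λ j → iter p j x) (m≡m%n+[m/n]*n m k))
                         (trans (iter-+ (m % k) (m / k * k) x) (cong (iter p (m % k)) (iter-* k x e (m / k))))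

  IsPeriod : Fin n → ℕ → Set
  IsPeriod x k = 0 < k × iter p k x ≡ x × (∀ m → 0 < m → m < k → iter p m x ≢ x)

  isPeriod-unique : ∀ {x k k′} → IsPeriod x k → IsPeriod x k′ → k ≡ k′
  isPeriod-unique {k = k} {k′} (k>0 , ek , mink) (k′>0 , ek′ , mink′) with <-cmp k k′
  ... | tri< k<k′ _ _ = contradiction ek (mink′ k k>0 k<k′)
  ... | tri≈ _ k≡k′ _ = k≡k′
  ... | tri> _ _ k′<k = contradiction ek′ (mink k′ k′>0 k′<k)

  return-time : ∀ x → Σ ℕ λ d → 0 < d × d ≤ n × iter p d x ≡ x
  return-time x with pigeonhole (n<1+n n) (λ (a : Fin (suc n)) → iter p (toℕ a) x)
  ... | i , j , i<j , eij = toℕ j ∸ toℕ i , m<n⇒0<n∸m i<j , ≤-trans (m∸n≤m (toℕ j) (toℕ i)) (≤-pred (toℕ<n j)) ,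
        iter-injective (toℕ i) (trans (iter-comm (toℕ i) (toℕ j ∸ toℕ i) x)
                                      (trans (sym (iter-∸ {toℕ i} {toℕ j} x (<⇒≤ i<j))) (sym eij)))

  private
    Returns : Fin n → ∀ d → Pred (Fin d) 0ℓ
    Returns x d a = 0 < toℕ a × iter p (toℕ a) x ≡ x

    returns? : ∀ x d → Decidable (Returns x d)
    returns? x d a = (0 <? toℕ a) ×-dec (iter p (toℕ a) x ≟ x)

    returns : ∀ x {m d} (m<d : m < d) → 0 < m → iter p m x ≡ x → Returns x d (fromℕ< m<d)
    returns x m<d m>0 em = subst (0 <_) (sym (toℕ-fromℕ< m<d)) m>0 , trans (cong (λ j → iter p j x) (toℕ-fromℕ< m<d)) em

  least-return-time : ∀ x d → 0 < d → iter p d x ≡ x → Σ ℕ λ k → k ≤ d × IsPeriod x k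
  least-return-time x d d>0 ed with leastWitness (returns? x (suc d)) _ (returns x (n<1+n d) d>0 ed)
  ... | k , (k>0 , ek) , least = toℕ k , ≤-pred (toℕ<n k) , k>0 , ek , minimal
    where
    minimal : ∀ m → 0 < m → m < toℕ k → iter p m x ≢ x
    minimal m m>0 m<k em = <-irrefl refl (≤-<-trans (subst (toℕ k ≤_) (toℕ-fromℕ< m<1+d) (least _ (returns x m<1+d m>0 em))) m<k)
      where
      m<1+d : m < suc d
      m<1+d = <-trans m<k (toℕ<n k)

  -- Opaque so that the search for the period is never unfolded.
  opaque
    period-spec : ∀ x → Σ ℕ λ k → k ≤ n × IsPeriod x k
    period-spec x with return-time x
    ... | d , d>0 , d≤n , ed with least-return-time x d d>0 ed
    ...   | k , k≤d , per = k , ≤-trans k≤d d≤n , per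

  period : Fin n → ℕ
  period x = proj₁ (period-spec x)

  period≤n : ∀ x → period x ≤ n
  period≤n x = proj₁ (proj₂ (period-spec x))

  isPeriod-period : ∀ x → IsPeriod x (period x)
  isPeriod-period x = proj₂ (proj₂ (period-spec x))

  period>0 : ∀ x → 0 < period x
  period>0 x = proj₁ (isPeriod-period x)

  iter-period : ∀ x → iter p (period x) x ≡ x
  iter-period x = proj₁ (proj₂ (isPeriod-period x))

  iter-period-minimal : ∀ x m → 0 < m → m < period x → iter p m x ≢ x
  iter-period-minimal x = proj₂ (proj₂ (isPeriod-period x))

  isPeriod-iter : ∀ a u → IsPeriod (iter p a u) (period u)
  isPeriod-iter a u = period>0 u , trans (iter-comm (period u) a u) (cong (iter p a) (iter-period u)) ,
    λ m m>0 m<k e → iter-period-minimal u m m>0 m<k (iter-injective a (trans (iter-comm a m u) e))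

  period-iter : ∀ a u → period (iter p a u) ≡ period u
  period-iter a u = isPeriod-unique (isPeriod-period _) (isPeriod-iter a u)

  iter-injective-below-period : ∀ u {a b} → a < period u → b < period u → iter p a u ≡ iter p b u → a ≡ b
  iter-injective-below-period u {a} {b} a<k b<k e with <-cmp a b
  ... | tri≈ _ a≡b _ = a≡b
  ... | tri< a<b _ _ = contradiction (iter-injective a (trans (iter-comm a (b ∸ a) u) (trans (sym (iter-∸ u (<⇒≤ a<b))) (sym e))))
                                     (iter-period-minimal u (b ∸ a) (m<n⇒0<n∸m a<b) (≤-<-trans (m∸n≤m b a) b<k))
  ... | tri> _ _ b<a = contradiction (iter-injective b (trans (iter-comm b (a ∸ b) u) (trans (sym (iter-∸ u (<⇒≤ b<a))) e)))
                                     (iter-period-minimal u (a ∸ b) (m<n⇒0<n∸m b<a) (≤-<-trans (m∸n≤m a b) a<k))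

  OnCycle : Fin n → Fin n → Set
  OnCycle u y = Σ (Fin (period u)) λ a → iter p (toℕ a) u ≡ y

  onCycle? : ∀ u → Decidable (OnCycle u)
  onCycle? u y = any? (λ a → iter p (toℕ a) u ≟ y)

  onCycle-iter : ∀ u m → OnCycle u (iter p m u)
  onCycle-iter u m = fromℕ< m%k<k , trans (cong (λ j → iter p j u) (toℕ-fromℕ< m%k<k)) (sym (iter-% (period u) u (iter-period u) m))
    where
    instance
      k≢0 : NonZero (period u)
      k≢0 = >-nonZero (period>0 u)
    m%k<k : m % period u < period u
    m%k<k = m%n<n m (period u)

  onCycle-refl : ∀ u → OnCycle u u
  onCycle-refl u = onCycle-iter u 0

  onCycle-iterʳ : ∀ {u y} → OnCycle u y → ∀ m → OnCycle u (iter p m y)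
  onCycle-iterʳ {u} (a , refl) m = subst (OnCycle u) (iter-+ m (toℕ a) u) (onCycle-iter u (m + toℕ a))

  onCycle-trans : ∀ {u v y} → OnCycle u v → OnCycle v y → OnCycle u y
  onCycle-trans c (b , refl) = onCycle-iterʳ c (toℕ b)

  onCycle-sym : ∀ {u y} → OnCycle u y → OnCycle y u
  onCycle-sym {u} (a , refl) = subst (OnCycle (iter p (toℕ a) u)) back (onCycle-iter _ (period u ∸ toℕ a))
    where
    back : iter p (period u ∸ toℕ a) (iter p (toℕ a) u) ≡ u
    back = trans (sym (iter-∸ u (<⇒≤ (toℕ<n a)))) (iter-period u)

  onCycle-p : ∀ {u y} → OnCycle u y → OnCycle u (p y)
  onCycle-p c = onCycle-iterʳ c 1

  onCycle-p⁻ : ∀ {u y} → OnCycle u (p y) → OnCycle u y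
  onCycle-p⁻ {y = y} c = onCycle-trans c (onCycle-sym (onCycle-iter y 1))

  period-onCycle : ∀ {u y} → OnCycle u y → period y ≡ period u
  period-onCycle {u} (a , refl) = period-iter (toℕ a) u

  Reverses : Pred (Fin n) 0ℓ → (Fin n → Fin n) → Set
  Reverses S σ = ∀ y → S y → p (σ (p y)) ≡ σ y

  reverses-iter : ∀ {S σ} → (∀ y → S y → S (p y)) → Reverses S σ → ∀ a y → S y → iter p a (σ (iter p a y)) ≡ σ y
  reverses-iter closed rev zero    y s = refl
  reverses-iter {S} {σ} closed rev (suc a) y s = begin
    iter p (suc a) (σ (p (iter p a y)))     ≡⟨ cong (λ j → iter p j (σ (p (iter p a y)))) (+-comm 1 a) ⟩
    iter p (a + 1) (σ (p (iter p a y)))     ≡⟨ iter-+ a 1 _ ⟩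
    iter p a (p (σ (p (iter p a y))))       ≡⟨ cong (iter p a) (rev (iter p a y) (S-iter a)) ⟩
    iter p a (σ (iter p a y))               ≡⟨ reverses-iter closed rev a y s ⟩
    σ y ∎
    where
    open ≡-Reasoning
    S-iter : ∀ m → S (iter p m y)
    S-iter zero    = s
    S-iter (suc m) = closed _ (S-iter m)

module Splittings {n : ℕ} (π : Permutation′ n) where

  open import Data.Nat using (ℕ; zero; suc; _+_; _∸_; _≤_; _<_; z≤n)
  open import Data.Nat.Properties using (m+[n∸m]≡n; m≤n⇒m<n∨m≡n; n∸n≡0; <⇒≤; +-∸-assoc)
  open import Data.Bool using (Bool; true; false; T; _∧_; not)
  open import Data.Fin using (Fin; toℕ)
  open import Data.Fin.Properties using (toℕ<n)
  open import Data.Sum using (_⊎_; inj₁; inj₂; [_,_])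
  import Data.Sum
  open import Function using (_∘_)
  open import Data.Fin.Properties using (_≟_; all?)
  open import Data.Fin.Permutation using (Permutation′)
  open import Data.Product using (_×_; _,_; proj₁; proj₂)
  open import Relation.Nullary using (Dec; yes; no; ¬_; contradiction)
  open import Relation.Nullary.Decidable using (_×-dec_; _→-dec_; _⊎-dec_; ¬?; T?; isYes; toWitness; fromWitness)
  open import Relation.Unary using (Decidable)
  open import Relation.Binary.PropositionalEquality hiding ([_])
  open Counting using (count; count-bijection)
  open Finite using (allVecs; allVecs-isEnumeration)
  open import Data.Vec using (Vec; lookup; tabulate)
  open import Data.Vec.Properties using (lookup∘tabulate; tabulate∘lookup; tabulate-cong)

  open Orbits π

  infix 4 _∈_ _∉_

  _∈_ : Fin n → (Fin n → Bool) → Set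
  x ∈ U = T (U x)

  _∉_ : Fin n → (Fin n → Bool) → Set
  x ∉ U = ¬ x ∈ U

  _∖_ : (Fin n → Bool) → (Fin n → Bool) → Fin n → Bool
  (U ∖ V) y = U y ∧ not (V y)

  ∈-∖⁺ : ∀ {U V y} → y ∈ U → y ∉ V → y ∈ U ∖ V
  ∈-∖⁺ {U} {V} {y} y∈U y∉V with U y | V y
  ... | true | false = _
  ... | true | true  = y∉V _

  ∈-∖⁻ : ∀ {U V y} → y ∈ U ∖ V → y ∈ U × y ∉ V
  ∈-∖⁻ {U} {V} {y} y∈U∖V with U y | V y
  ... | true | false = _ , λ ()

  cycleOf : Fin n → Fin n → Bool
  cycleOf x y = isYes (onCycle? x y)

  ∈cycleOf⁺ : ∀ {x y} → OnCycle x y → y ∈ cycleOf x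
  ∈cycleOf⁺ {x} {y} = fromWitness {a? = onCycle? x y}

  ∈cycleOf⁻ : ∀ {x y} → y ∈ cycleOf x → OnCycle x y
  ∈cycleOf⁻ {x} {y} = toWitness {a? = onCycle? x y}

  record Closed (U : Fin n → Bool) : Set where
    constructor p-invariant
    field invariant : ∀ x → U (p x) ≡ U x

  open Closed public

  ∈-p : ∀ {U} → Closed U → ∀ {y} → y ∈ U → p y ∈ U
  ∈-p closed {y} = subst T (sym (invariant closed y))

  closed-∖ : ∀ {U V} → Closed U → Closed V → Closed (U ∖ V)
  closed-∖ closedU closedV = p-invariant λ y → cong₂ (λ a b → a ∧ not b) (invariant closedU y) (invariant closedV y)

  closed-cycleOf : ∀ x → Closed (cycleOf x)
  closed-cycleOf x = p-invariant invariant-cycleOf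
    where
    invariant-cycleOf : ∀ y → cycleOf x (p y) ≡ cycleOf x y
    invariant-cycleOf y with onCycle? x (p y) | onCycle? x y
    ... | yes _ | yes _ = refl
    ... | no  _ | no  _ = refl
    ... | yes c | no ¬c = contradiction (onCycle-p⁻ c) ¬c
    ... | no ¬c | yes c = contradiction (onCycle-p c) ¬c

  closed-iter : ∀ {U} → Closed U → ∀ m {y} → y ∈ U → iter p m y ∈ U
  closed-iter closed zero    y∈U = y∈U
  closed-iter closed (suc m) y∈U = ∈-p closed (closed-iter closed m y∈U)

  closed-onCycle : ∀ {U} → Closed U → ∀ {u y} → u ∈ U → OnCycle u y → y ∈ U
  closed-onCycle closed u∈U (a , refl) = closed-iter closed (toℕ a) u∈U

  -- On the whole set, splittings σ are exactly the factorizations π = (π ∘ σ) ∘ σ into involutions.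
  SplitsAt : (Fin n → Bool) → (Fin n → Fin n) → Fin n → Set
  SplitsAt U σ i = (i ∉ U → σ i ≡ i) × σ (σ i) ≡ i × (i ∈ U → p (σ (p (σ i))) ≡ i)

  Splitting : (Fin n → Bool) → (Fin n → Fin n) → Set
  Splitting U σ = ∀ i → SplitsAt U σ i

  splitting? : ∀ U → Decidable (Splitting U)
  splitting? U σ = all? λ i →
    (¬? (T? (U i)) →-dec (σ i ≟ i)) ×-dec (σ (σ i) ≟ i) ×-dec (T? (U i) →-dec (p (σ (p (σ i))) ≟ i))

  splitting-resp : ∀ {U σ σ′} → (∀ i → σ i ≡ σ′ i) → Splitting U σ → Splitting U σ′
  splitting-resp {σ = σ} {σ′} σ≗σ′ s i =
    (λ i∉U → trans (sym (σ≗σ′ i)) (proj₁ (s i) i∉U)) ,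
    trans (sym (trans (cong σ (σ≗σ′ i)) (σ≗σ′ (σ′ i)))) (proj₁ (proj₂ (s i))) ,
    (λ i∈U → trans (cong p (trans (cong (λ z → σ′ (p z)) (sym (σ≗σ′ i))) (sym (σ≗σ′ (p (σ i)))))) (proj₂ (proj₂ (s i)) i∈U))

  module SplittingProperties {U} (closed : Closed U) {σ} (splitting : Splitting U σ) where

    fixes : ∀ {i} → i ∉ U → σ i ≡ i
    fixes {i} = proj₁ (splitting i)

    involutive : ∀ i → σ (σ i) ≡ i
    involutive i = proj₁ (proj₂ (splitting i))

    injective : ∀ {x y} → σ x ≡ σ y → x ≡ y
    injective {x} {y} e = trans (sym (involutive x)) (trans (cong σ e) (involutive y))

    preserves : ∀ {i} → i ∈ U → σ i ∈ U
    preserves {i} i∈U with T? (U (σ i))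
    ... | yes σi∈U = σi∈U
    ... | no σi∉U = contradiction (subst (_∈ U) (sym (trans (sym (fixes σi∉U)) (involutive i))) i∈U) σi∉U

    reverses : Reverses (_∈ U) σ
    reverses y y∈U = trans (cong (λ z → p (σ (p z))) (sym (involutive y))) (proj₂ (proj₂ (splitting (σ y))) (preserves y∈U))

    reverses-iterᵤ : ∀ a {y} → y ∈ U → iter p a (σ (iter p a y)) ≡ σ y
    reverses-iterᵤ a = reverses-iter (λ _ → ∈-p closed) reverses a _

    period-σ : ∀ {u} → u ∈ U → period (σ u) ≡ period u
    period-σ {u} u∈U = isPeriod-unique (isPeriod-period (σ u)) (period>0 u , returns , minimal)
      where
      returns : iter p (period u) (σ u) ≡ σ u
      returns = trans (cong (λ z → iter p (period u) (σ z)) (sym (iter-period u))) (reverses-iterᵤ (period u) u∈U)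
      minimal : ∀ m → 0 < m → m < period u → iter p m (σ u) ≢ σ u
      minimal m m>0 m<k e = iter-period-minimal u m m>0 m<k (injective (iter-injective m (trans (reverses-iterᵤ m u∈U) (sym e))))

    σ-iter : ∀ {u} → u ∈ U → ∀ a → a ≤ period u → σ (iter p a u) ≡ iter p (period u ∸ a) (σ u)
    σ-iter {u} u∈U a a≤k = iter-injective a (begin
      iter p a (σ (iter p a u))                    ≡⟨ reverses-iterᵤ a u∈U ⟩
      σ u                                          ≡⟨ sym (iter-period (σ u)) ⟩
      iter p (period (σ u)) (σ u)                  ≡⟨ cong (λ k → iter p k (σ u)) (trans (period-σ u∈U) (sym (m+[n∸m]≡n a≤k))) ⟩
      iter p (a + (period u ∸ a)) (σ u)            ≡⟨ iter-+ a (period u ∸ a) (σ u) ⟩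
      iter p a (iter p (period u ∸ a) (σ u)) ∎)
      where open ≡-Reasoning

  -- Fixing σ u = v ties the cycles of u and v together; what is left is a splitting of U without them.
  module Pairing {U} (closed : Closed U) {u v} (u∈U : u ∈ U) (v∈U : v ∈ U) (same-period : period v ≡ period u) where

    k : ℕ
    k = period u

    InPair : Fin n → Set
    InPair x = OnCycle u x ⊎ OnCycle v x

    inPair? : Decidable InPair
    inPair? x = onCycle? u x ⊎-dec onCycle? v x

    W : Fin n → Bool
    W = (U ∖ cycleOf u) ∖ cycleOf v

    closed-W : Closed W
    closed-W = closed-∖ (closed-∖ closed (closed-cycleOf u)) (closed-cycleOf v)

    ∈W⁺ : ∀ {y} → y ∈ U → ¬ InPair y → y ∈ W
    ∈W⁺ y∈U ¬pair = ∈-∖⁺ {U ∖ cycleOf u} {cycleOf v} (∈-∖⁺ {U} {cycleOf u} y∈U (¬pair ∘ inj₁ ∘ ∈cycleOf⁻))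
                                                      (¬pair ∘ inj₂ ∘ ∈cycleOf⁻)

    ∈W⁻ : ∀ {y} → y ∈ W → y ∈ U × ¬ InPair y
    ∈W⁻ y∈W with ∈-∖⁻ {U ∖ cycleOf u} {cycleOf v} y∈W
    ... | y∈U∖Cu , y∉Cv with ∈-∖⁻ {U} {cycleOf u} y∈U∖Cu
    ...   | y∈U , y∉Cu = y∈U , [ y∉Cu ∘ ∈cycleOf⁺ , y∉Cv ∘ ∈cycleOf⁺ ]

    inPair⇒∈U : ∀ {y} → InPair y → y ∈ U
    inPair⇒∈U (inj₁ c) = closed-onCycle closed u∈U c
    inPair⇒∈U (inj₂ c) = closed-onCycle closed v∈U c

    inPair⇒∉W : ∀ {y} → InPair y → y ∉ W
    inPair⇒∉W pair y∈W = proj₂ (∈W⁻ y∈W) pair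

    inPair-p : ∀ {y} → InPair y → InPair (p y)
    inPair-p = Data.Sum.map onCycle-p onCycle-p

    ¬inPair-p : ∀ {y} → ¬ InPair y → ¬ InPair (p y)
    ¬inPair-p ¬pair = ¬pair ∘ Data.Sum.map onCycle-p⁻ onCycle-p⁻

    iter-k-v : iter p k v ≡ v
    iter-k-v = subst (λ m → iter p m v ≡ v) same-period (iter-period v)

    restrict : (Fin n → Fin n) → Fin n → Fin n
    restrict σ x with inPair? x
    ... | yes _ = x
    ... | no  _ = σ x

    restrict-inside : ∀ σ {x} → InPair x → restrict σ x ≡ x
    restrict-inside σ {x} pair with inPair? x
    ... | yes _    = refl
    ... | no ¬pair = contradiction pair ¬pair

    restrict-outside : ∀ σ {x} → ¬ InPair x → restrict σ x ≡ σ x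
    restrict-outside σ {x} ¬pair with inPair? x
    ... | yes pair = contradiction pair ¬pair
    ... | no  _    = refl

    restrict-cong : ∀ σ σ′ x → σ x ≡ σ′ x → restrict σ x ≡ restrict σ′ x
    restrict-cong σ σ′ x e with inPair? x
    ... | yes _ = refl
    ... | no  _ = e

    extend : (Fin n → Fin n) → Fin n → Fin n
    extend τ x with onCycle? u x | onCycle? v x
    ... | yes (a , _) | _           = iter p (k ∸ toℕ a) v
    ... | no _        | yes (b , _) = iter p (k ∸ toℕ b) u
    ... | no _        | no _        = τ x

    extend-cong : ∀ τ τ′ x → τ x ≡ τ′ x → extend τ x ≡ extend τ′ x
    extend-cong τ τ′ x e with onCycle? u x | onCycle? v x
    ... | yes _ | _     = refl
    ... | no _  | yes _ = refl
    ... | no _  | no _  = e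

    extend-outside : ∀ τ {x} → ¬ InPair x → extend τ x ≡ τ x
    extend-outside τ {x} ¬pair with onCycle? u x | onCycle? v x
    ... | yes c | _     = contradiction (inj₁ c) ¬pair
    ... | no _  | yes c = contradiction (inj₂ c) ¬pair
    ... | no _  | no _  = refl

    private
      extend-u< : ∀ τ a → a < k → extend τ (iter p a u) ≡ iter p (k ∸ a) v
      extend-u< τ a a<k with onCycle? u (iter p a u)
      ... | yes (a′ , e) = cong (λ j → iter p (k ∸ j) v) (iter-injective-below-period u (toℕ<n a′) a<k e)
      ... | no ¬c        = contradiction (onCycle-iter u a) ¬c

      extend-v< : ∀ τ b → b < k → ¬ OnCycle u (iter p b v) → extend τ (iter p b v) ≡ iter p (k ∸ b) u
      extend-v< τ b b<k ¬c with onCycle? u (iter p b v) | onCycle? v (iter p b v)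
      ... | yes c       | _           = contradiction c ¬c
      ... | no _        | yes (b′ , e) = cong (λ j → iter p (k ∸ j) u)
                                            (iter-injective-below-period v (toℕ<n b′) (subst (b <_) (sym same-period) b<k) e)
      ... | no _        | no ¬c′      = contradiction (onCycle-iter v b) ¬c′

    extend-u : ∀ τ a → a ≤ k → extend τ (iter p a u) ≡ iter p (k ∸ a) v
    extend-u τ a a≤k with m≤n⇒m<n∨m≡n a≤k
    ... | inj₁ a<k  = extend-u< τ a a<k
    ... | inj₂ refl = begin
      extend τ (iter p k u)   ≡⟨ cong (extend τ) (iter-period u) ⟩
      extend τ u              ≡⟨ extend-u< τ 0 (period>0 u) ⟩
      iter p k v              ≡⟨ iter-k-v ⟩
      v                       ≡⟨ cong (λ j → iter p j v) (sym (n∸n≡0 k)) ⟩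
      iter p (k ∸ k) v ∎
      where open ≡-Reasoning

    extend-v : ∀ τ b → b ≤ k → ¬ OnCycle u (iter p b v) → extend τ (iter p b v) ≡ iter p (k ∸ b) u
    extend-v τ b b≤k ¬c with m≤n⇒m<n∨m≡n b≤k
    ... | inj₁ b<k  = extend-v< τ b b<k ¬c
    ... | inj₂ refl = begin
      extend τ (iter p k v)   ≡⟨ cong (extend τ) iter-k-v ⟩
      extend τ v              ≡⟨ extend-v< τ 0 (period>0 u) (¬c ∘ subst (OnCycle u) (sym iter-k-v)) ⟩
      iter p k u              ≡⟨ iter-period u ⟩
      u                       ≡⟨ cong (λ j → iter p j u) (sym (n∸n≡0 k)) ⟩
      iter p (k ∸ k) u ∎
      where open ≡-Reasoning

    private
      toℕ≤k-u : ∀ (a : Fin (period u)) → toℕ a ≤ k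
      toℕ≤k-u a = <⇒≤ (toℕ<n a)

      toℕ≤k-v : ∀ (b : Fin (period v)) → toℕ b ≤ k
      toℕ≤k-v b = subst (toℕ b ≤_) same-period (<⇒≤ (toℕ<n b))

    data Position (x : Fin n) : Set where
      on-u    : (a : Fin (period u)) → iter p (toℕ a) u ≡ x → Position x
      on-v    : ¬ OnCycle u x → (b : Fin (period v)) → iter p (toℕ b) v ≡ x → Position x
      outside : ¬ InPair x → Position x

    position : ∀ x → Position x
    position x with onCycle? u x | onCycle? v x
    ... | yes (a , e) | _           = on-u a e
    ... | no ¬cu      | yes (b , e) = on-v ¬cu b e
    ... | no ¬cu      | no ¬cv      = outside [ ¬cu , ¬cv ]

    module Restriction {σ} (splitting : Splitting U σ) (σu≡v : σ u ≡ v) where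
      open SplittingProperties closed splitting

      σv≡u : σ v ≡ u
      σv≡u = trans (cong σ (sym σu≡v)) (involutive u)

      σ-iter-u : ∀ a → a ≤ k → σ (iter p a u) ≡ iter p (k ∸ a) v
      σ-iter-u a a≤k = trans (σ-iter u∈U a a≤k) (cong (iter p (k ∸ a)) σu≡v)

      σ-iter-v : ∀ b → b ≤ k → σ (iter p b v) ≡ iter p (k ∸ b) u
      σ-iter-v b b≤k = begin
        σ (iter p b v)                    ≡⟨ σ-iter v∈U b (subst (b ≤_) (sym same-period) b≤k) ⟩
        iter p (period v ∸ b) (σ v)       ≡⟨ cong₂ (λ j z → iter p (j ∸ b) z) same-period σv≡u ⟩
        iter p (k ∸ b) u ∎
        where open ≡-Reasoning

      inPair-σ : ∀ {x} → InPair x → InPair (σ x)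
      inPair-σ (inj₁ (a , refl)) = inj₂ (subst (OnCycle v) (sym (σ-iter-u (toℕ a) (toℕ≤k-u a))) (onCycle-iter v (k ∸ toℕ a)))
      inPair-σ (inj₂ (b , refl)) = inj₁ (subst (OnCycle u) (sym (σ-iter-v (toℕ b) (toℕ≤k-v b))) (onCycle-iter u (k ∸ toℕ b)))

      ¬inPair-σ : ∀ {x} → ¬ InPair x → ¬ InPair (σ x)
      ¬inPair-σ ¬pair pair = ¬pair (subst InPair (involutive _) (inPair-σ pair))

      extend-restrict : ∀ x → extend (restrict σ) x ≡ σ x
      extend-restrict x with position x
      ... | on-u a refl = trans (extend-u _ (toℕ a) (toℕ≤k-u a)) (sym (σ-iter-u (toℕ a) (toℕ≤k-u a)))
      ... | on-v ¬cu b refl = trans (extend-v _ (toℕ b) (toℕ≤k-v b) ¬cu) (sym (σ-iter-v (toℕ b) (toℕ≤k-v b)))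
      ... | outside ¬pair = trans (extend-outside _ ¬pair) (restrict-outside σ ¬pair)

      restrict-splitting : Splitting W (restrict σ)
      restrict-splitting i = splitsAt (inPair? i)
        where
        splitsAt : Dec (InPair i) → SplitsAt W (restrict σ) i
        splitsAt (yes pair) = (λ _ → restrict-inside σ pair) ,
                           trans (cong (restrict σ) (restrict-inside σ pair)) (restrict-inside σ pair) ,
                           (λ i∈W → contradiction i∈W (inPair⇒∉W pair))
        splitsAt (no ¬pair) = (λ i∉W → trans (restrict-outside σ ¬pair) (fixes (λ i∈U → i∉W (∈W⁺ i∈U ¬pair)))) ,
                           trans (cong (restrict σ) (restrict-outside σ ¬pair))
                                 (trans (restrict-outside σ (¬inPair-σ ¬pair)) (involutive i)) ,
                           (λ i∈W → trans (cong (λ z → p (restrict σ (p z))) (restrict-outside σ ¬pair))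
                                          (trans (cong p (restrict-outside σ (¬inPair-p (¬inPair-σ ¬pair))))
                                                 (proj₂ (proj₂ (splitting i)) (proj₁ (∈W⁻ i∈W)))))

    module Extension {τ} (splitting : Splitting W τ) where
      open SplittingProperties closed-W splitting
        renaming (fixes to fixesᵂ; involutive to involutiveᵂ; preserves to preservesᵂ)

      σ : Fin n → Fin n
      σ = extend τ

      σu≡v : σ u ≡ v
      σu≡v = trans (extend-u τ 0 z≤n) iter-k-v

      σv≡u : σ v ≡ u
      σv≡u with position v
      ... | on-u a e = begin
        σ v                               ≡⟨ cong σ (sym e) ⟩
        σ (iter p (toℕ a) u)              ≡⟨ extend-u τ (toℕ a) (toℕ≤k-u a) ⟩
        iter p (k ∸ toℕ a) v              ≡⟨ cong (iter p (k ∸ toℕ a)) (sym e) ⟩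
        iter p (k ∸ toℕ a) (iter p (toℕ a) u) ≡⟨ sym (iter-∸ u (toℕ≤k-u a)) ⟩
        iter p k u                        ≡⟨ iter-period u ⟩
        u ∎
        where open ≡-Reasoning
      ... | on-v ¬cu _ _  = trans (extend-v τ 0 z≤n ¬cu) (iter-period u)
      ... | outside ¬pair = contradiction (inj₂ (onCycle-refl v)) ¬pair

      inPair-σ : ∀ {x} → InPair x → InPair (σ x)
      inPair-σ {x} pair with position x
      ... | on-u a refl    = inj₂ (subst (OnCycle v) (sym (extend-u τ (toℕ a) (toℕ≤k-u a))) (onCycle-iter v (k ∸ toℕ a)))
      ... | on-v ¬cu b refl = inj₁ (subst (OnCycle u) (sym (extend-v τ (toℕ b) (toℕ≤k-v b) ¬cu)) (onCycle-iter u (k ∸ toℕ b)))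
      ... | outside ¬pair  = contradiction pair ¬pair

      reverses-pair : Reverses InPair σ
      reverses-pair y pair with position y
      ... | on-u a refl = begin
        p (σ (iter p (suc (toℕ a)) u))        ≡⟨ cong p (extend-u τ (suc (toℕ a)) (toℕ<n a)) ⟩
        iter p (suc (k ∸ suc (toℕ a))) v      ≡⟨ cong (λ j → iter p j v) (sym (+-∸-assoc 1 (toℕ<n a))) ⟩
        iter p (k ∸ toℕ a) v                  ≡⟨ sym (extend-u τ (toℕ a) (toℕ≤k-u a)) ⟩
        σ (iter p (toℕ a) u) ∎
        where open ≡-Reasoning
      ... | on-v ¬cu b refl = begin
        p (σ (iter p (suc (toℕ b)) v))        ≡⟨ cong p (extend-v τ (suc (toℕ b)) b<k (¬cu ∘ onCycle-p⁻)) ⟩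
        iter p (suc (k ∸ suc (toℕ b))) u      ≡⟨ cong (λ j → iter p j u) (sym (+-∸-assoc 1 b<k)) ⟩
        iter p (k ∸ toℕ b) u                  ≡⟨ sym (extend-v τ (toℕ b) (toℕ≤k-v b) ¬cu) ⟩
        σ (iter p (toℕ b) v) ∎
        where
        open ≡-Reasoning
        b<k : toℕ b < k
        b<k = subst (toℕ b <_) same-period (toℕ<n b)
      ... | outside ¬pair = contradiction pair ¬pair

      reverses-iter-pair : ∀ a {y} → InPair y → iter p a (σ (iter p a y)) ≡ σ y
      reverses-iter-pair a = reverses-iter (λ _ → inPair-p) reverses-pair a _

      -- σ is determined along a cycle by its value at one point, so involutivity propagates from u and v.
      involutive-iter : ∀ a {y} → InPair y → σ (σ y) ≡ y → σ (σ (iter p a y)) ≡ iter p a y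
      involutive-iter a {y} pair σσy≡y = begin
        σ (σ (iter p a y))                                 ≡⟨ sym (reverses-iter-pair a (inPair-σ (iter-inPair a pair))) ⟩
        iter p a (σ (iter p a (σ (iter p a y))))           ≡⟨ cong (λ z → iter p a (σ z)) (reverses-iter-pair a pair) ⟩
        iter p a (σ (σ y))                                 ≡⟨ cong (iter p a) σσy≡y ⟩
        iter p a y ∎
        where
        open ≡-Reasoning
        iter-inPair : ∀ a {y} → InPair y → InPair (iter p a y)
        iter-inPair zero    pair = pair
        iter-inPair (suc a) pair = inPair-p (iter-inPair a pair)

      involutive-pair : ∀ {x} → InPair x → σ (σ x) ≡ x
      involutive-pair (inj₁ (a , refl)) = involutive-iter (toℕ a) (inj₁ (onCycle-refl u)) (trans (cong σ σu≡v) σv≡u)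
      involutive-pair (inj₂ (b , refl)) = involutive-iter (toℕ b) (inj₂ (onCycle-refl v)) (trans (cong σ σv≡u) σu≡v)

      extend-splitting : Splitting U σ
      extend-splitting i = splitsAt (inPair? i)
        where
        splitsAt : Dec (InPair i) → SplitsAt U σ i
        splitsAt (yes pair) = (λ i∉U → contradiction (inPair⇒∈U pair) i∉U) ,
                              involutive-pair pair ,
                              (λ _ → trans (reverses-pair (σ i) (inPair-σ pair)) (involutive-pair pair))
        splitsAt (no ¬pair) = (λ i∉U → trans (extend-outside τ ¬pair) (fixesᵂ (i∉U ∘ proj₁ ∘ ∈W⁻))) ,
                              involutive-outside (T? (W i)) ,
                              (λ i∈U → reverses-outside (∈W⁺ i∈U ¬pair))
          where
          σi≡τi : σ i ≡ τ i
          σi≡τi = extend-outside τ ¬pair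
          involutive-outside : Dec (i ∈ W) → σ (σ i) ≡ i
          involutive-outside (yes i∈W) =
            trans (cong σ σi≡τi) (trans (extend-outside τ (proj₂ (∈W⁻ (preservesᵂ i∈W)))) (involutiveᵂ i))
          involutive-outside (no i∉W)  = trans (cong σ (trans σi≡τi (fixesᵂ i∉W))) (trans σi≡τi (fixesᵂ i∉W))
          reverses-outside : i ∈ W → p (σ (p (σ i))) ≡ i
          reverses-outside i∈W = begin
            p (σ (p (σ i)))   ≡⟨ cong (λ z → p (σ (p z))) σi≡τi ⟩
            p (σ (p (τ i)))   ≡⟨ cong p (extend-outside τ (proj₂ (∈W⁻ (∈-p closed-W (preservesᵂ i∈W))))) ⟩
            p (τ (p (τ i)))   ≡⟨ proj₂ (proj₂ (splitting i)) i∈W ⟩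
            i ∎
            where open ≡-Reasoning

      restrict-extend : ∀ x → restrict σ x ≡ τ x
      restrict-extend x with inPair? x
      ... | yes pair = sym (fixesᵂ (inPair⇒∉W pair))
      ... | no ¬pair = extend-outside τ ¬pair

    count-splittings-pair : count (λ w → splitting? U (lookup w) ×-dec (lookup w u ≟ v)) (allVecs n n)
                          ≡ count (λ w → splitting? W (lookup w)) (allVecs n n)
    count-splittings-pair =
      count-bijection (allVecs-isEnumeration n n) (allVecs-isEnumeration n n)
        (λ w → splitting? U (lookup w) ×-dec (lookup w u ≟ v)) (λ w → splitting? W (lookup w))
        restrictᵥ extendᵥ
        (λ w (s , e) → splitting-resp (λ i → sym (lookup∘tabulate _ i)) (Restriction.restrict-splitting s e))
        (λ w s → splitting-resp (λ i → sym (lookup∘tabulate _ i)) (Extension.extend-splitting s) ,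
                 trans (lookup∘tabulate _ u) (Extension.σu≡v s))
        (λ w (s , e) → trans (tabulate-cong λ x → trans (extend-cong _ _ x (lookup∘tabulate _ x)) (Restriction.extend-restrict s e x))
                             (tabulate∘lookup w))
        (λ w s → trans (tabulate-cong λ x → trans (restrict-cong _ _ x (lookup∘tabulate _ x)) (Extension.restrict-extend s x))
                       (tabulate∘lookup w))
      where
      restrictᵥ extendᵥ : Vec (Fin n) n → Vec (Fin n) n
      restrictᵥ w = tabulate (restrict (lookup w))
      extendᵥ   w = tabulate (extend (lookup w))

module CycleCounts {n : ℕ} (π : Permutation′ n) where

  open import Data.Nat using (ℕ; zero; suc; _+_; _*_; _≤_; _<_; z<s)
  open import Data.Nat.Induction using (<-wellFounded)
  open import Data.Nat.Properties using (+-monoˡ-≤; *-zeroʳ; *-identityʳ; *-distribˡ-+; <-irrefl)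
  import Data.Nat.Properties as ℕ
  open import Data.Bool using (Bool)
  open import Data.Fin using (Fin; toℕ; fromℕ<) renaming (_≤_ to _≤ᶠ_)
  open import Data.Fin.Properties using (_≟_; any?; toℕ<n; toℕ-fromℕ<; toℕ-injective) renaming (≤-antisym to ≤ᶠ-antisym)
  open import Data.Fin.Permutation using (Permutation′)
  open import Data.List using (allFin; length)
  open import Data.List.Properties using (length-tabulate)
  open import Data.Product using (Σ; _×_; _,_; proj₁; proj₂)
  open import Data.Unit using (tt)
  open import Function using (_∘_)
  open import Induction.WellFounded using (module All)
  import Relation.Binary.Construct.On as On
  open import Level using (0ℓ)
  open import Relation.Unary using (Decidable)
  open import Relation.Nullary using (Dec; yes; no; ¬_; contradiction)
  open import Relation.Nullary.Decidable using (_×-dec_; ¬?; T?)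
  open import Relation.Binary.PropositionalEquality
  open Counting
  open Finite using (allFin-isEnumeration; leastWitness)

  open Orbits π
  open Splittings π
  open ≡-Reasoning

  countIn : (Fin n → Bool) → {Q : Fin n → Set} → Decidable Q → ℕ
  countIn U Q? = count (λ i → T? (U i) ×-dec Q? i) (allFin n)

  countIn-∖-cycleOf : ∀ {U} → Closed U → ∀ {x} → x ∈ U → {Q : Fin n → Set} (Q? : Decidable Q) →
                      countIn U Q? ≡ count (λ i → Q? i ×-dec onCycle? x i) (allFin n) + countIn (U ∖ cycleOf x) Q?
  countIn-∖-cycleOf {U} closed {x} x∈U Q? =
    trans (count-split (λ i → T? (U i) ×-dec Q? i) (onCycle? x) (allFin n)) (cong₂ _+_ on-cycle off-cycle)
    where
    on-cycle : count (λ i → (T? (U i) ×-dec Q? i) ×-dec onCycle? x i) (allFin n)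
             ≡ count (λ i → Q? i ×-dec onCycle? x i) (allFin n)
    on-cycle = count-cong (λ i → (T? (U i) ×-dec Q? i) ×-dec onCycle? x i) (λ i → Q? i ×-dec onCycle? x i) (allFin n)
                          (λ _ ((_ , q) , c) → q , c) (λ _ (q , c) → (closed-onCycle closed x∈U c , q) , c)
    off-cycle : count (λ i → (T? (U i) ×-dec Q? i) ×-dec ¬? (onCycle? x i)) (allFin n) ≡ countIn (U ∖ cycleOf x) Q?
    off-cycle = count-cong (λ i → (T? (U i) ×-dec Q? i) ×-dec ¬? (onCycle? x i)) (λ i → T? ((U ∖ cycleOf x) i) ×-dec Q? i) (allFin n)
                           (λ _ ((i∈U , q) , ¬c) → ∈-∖⁺ {U} {cycleOf x} i∈U (¬c ∘ ∈cycleOf⁻) , q)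
                           (λ _ (i∈U∖C , q) → let i∈U , i∉C = ∈-∖⁻ {U} {cycleOf x} i∈U∖C in (i∈U , q) , i∉C ∘ ∈cycleOf⁺)

  countIn-empty : ∀ {U} → (∀ i → i ∉ U) → {Q : Fin n → Set} (Q? : Decidable Q) → countIn U Q? ≡ 0
  countIn-empty {U} empty Q? = count-none (λ i → T? (U i) ×-dec Q? i) (allFin n) (λ i (i∈U , _) → empty i i∈U)

  size : (Fin n → Bool) → ℕ
  size U = countIn U (λ _ → yes tt)

  size-∖ : ∀ U V → size (U ∖ V) ≤ size U
  size-∖ U V = count-mono (λ i → T? ((U ∖ V) i) ×-dec yes tt) (λ i → T? (U i) ×-dec yes tt) (allFin n)
                          (λ i (i∈U∖V , _) → proj₁ (∈-∖⁻ {U} {V} i∈U∖V) , tt)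

  size-∖-cycleOf : ∀ {U} → Closed U → ∀ {x} → x ∈ U → size (U ∖ cycleOf x) < size U
  size-∖-cycleOf {U} closed {x} x∈U =
    subst (size (U ∖ cycleOf x) <_) (sym (countIn-∖-cycleOf closed x∈U (λ _ → yes tt))) (+-monoˡ-≤ (size (U ∖ cycleOf x)) 1≤)
    where
    1≤ : 1 ≤ count (λ i → yes tt ×-dec onCycle? x i) (allFin n)
    1≤ = subst (_≤ count (λ i → yes tt ×-dec onCycle? x i) (allFin n)) (count-≟ (allFin-isEnumeration n) x)
               (count-mono (_≟ x) (λ i → yes tt ×-dec onCycle? x i) (allFin n) (λ { _ refl → tt , onCycle-refl x }))

  closed-induction : (Q : (Fin n → Bool) → Set) →
                     (∀ U → Closed U → (∀ V → Closed V → size V < size U → Q V) → Q U) →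
                     ∀ U → Closed U → Q U
  closed-induction Q step = All.wfRec (On.wellFounded size <-wellFounded) 0ℓ (λ U → Closed U → Q U)
                                      (λ U rec closed → step U closed (λ V closedV V<U → rec V<U closedV))

  count-onCycle : ∀ x → count (onCycle? x) (allFin n) ≡ period x
  count-onCycle x = begin
    count (onCycle? x) (allFin n)                       ≡⟨ sym (count-bijection (allFin-isEnumeration _) (allFin-isEnumeration n)
                                                                 (λ _ → yes tt) (onCycle? x) position index
                                                                 (λ a _ → a , refl) (λ _ _ → tt)
                                                                 (λ a _ → index-position a) (λ y c → position-index c)) ⟩
    count (λ _ → yes tt) (allFin (period x))            ≡⟨ count-all (λ _ → yes tt) (allFin (period x)) (λ _ → tt) ⟩
    length (allFin (period x))                          ≡⟨ length-tabulate (λ i → i) ⟩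
    period x ∎
    where
    position : Fin (period x) → Fin n
    position a = iter p (toℕ a) x
    index′ : ∀ {y} → Dec (OnCycle x y) → Fin (period x)
    index′ (yes (a , _)) = a
    index′ (no _)        = fromℕ< (period>0 x)
    index : Fin n → Fin (period x)
    index y = index′ (onCycle? x y)
    index-position : ∀ a → index (position a) ≡ a
    index-position a with onCycle? x (position a)
    ... | yes (a′ , e) = toℕ-injective (iter-injective-below-period x (toℕ<n a′) (toℕ<n a) e)
    ... | no ¬c        = contradiction (a , refl) ¬c
    position-index : ∀ {y} → OnCycle x y → position (index y) ≡ y
    position-index {y} c with onCycle? x y
    ... | yes (_ , e) = e
    ... | no ¬c       = contradiction c ¬c

  cycleRep-period : ∀ {k y} → 0 < k → IsCycleRep π k y → k ≡ period y
  cycleRep-period {k} {y} k>0 (returns , first , _) = isPeriod-unique (k>0 , returns , minimal) (isPeriod-period y)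
    where
    minimal : ∀ m → 0 < m → m < k → iter p m y ≢ y
    minimal m m>0 m<k e = <-irrefl (trans (sym (first (fromℕ< m<k) (subst (λ j → iter p j y ≡ y) (sym (toℕ-fromℕ< m<k)) e)))
                                          (toℕ-fromℕ< m<k)) m>0

  leastOnCycle : ∀ x → Σ (Fin n) λ y → OnCycle x y × (∀ z → OnCycle x z → y ≤ᶠ z)
  leastOnCycle x = leastWitness (onCycle? x) x (onCycle-refl x)

  cycleRep-least : ∀ x → IsCycleRep π (period x) (proj₁ (leastOnCycle x))
  cycleRep-least x with leastOnCycle x
  ... | y , c , least = returns , first , minimal
    where
    same-period : period y ≡ period x
    same-period = period-onCycle c
    returns : iter p (period x) y ≡ y
    returns = subst (λ k → iter p k y ≡ y) same-period (iter-period y)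
    first : ∀ (m : Fin (period x)) → iter p (toℕ m) y ≡ y → toℕ m ≡ 0
    first m e with toℕ m in eq
    ... | zero  = refl
    ... | suc j = contradiction e (iter-period-minimal y (suc j) z<s
                                     (subst (_< period y) eq (subst (toℕ m <_) (sym same-period) (toℕ<n m))))
    minimal : ∀ (m : Fin (period x)) → y ≤ᶠ iter p (toℕ m) y
    minimal m = least _ (onCycle-iterʳ c (toℕ m))

  cycleRep-unique : ∀ x {y} → OnCycle x y → IsCycleRep π (period x) y → y ≡ proj₁ (leastOnCycle x)
  cycleRep-unique x {y} c (_ , _ , minimal) with leastOnCycle x
  ... | z , cz , least = ≤ᶠ-antisym y≤z (least y c)
    where
    cyz : OnCycle y z
    cyz = onCycle-trans (onCycle-sym c) cz
    b = proj₁ cyz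
    b<k : toℕ b < period x
    b<k = subst (toℕ b <_) (period-onCycle c) (toℕ<n b)
    y≤z : y ≤ᶠ z
    y≤z = subst (y ≤ᶠ_) (trans (cong (λ j → iter p j y) (toℕ-fromℕ< b<k)) (proj₂ cyz)) (minimal (fromℕ< b<k))

  cycles : (Fin n → Bool) → ℕ → ℕ
  cycles U k = countIn U (isCycleRep? π k)

  cycles-∖-cycleOf : ∀ {U} → Closed U → ∀ {x} → x ∈ U → ∀ {k} → 0 < k →
                     cycles U k ≡ indicator (ℕ._≟ period x) k + cycles (U ∖ cycleOf x) k
  cycles-∖-cycleOf {U} closed {x} x∈U {k} k>0 =
    trans (countIn-∖-cycleOf closed x∈U (isCycleRep? π k)) (cong (_+ cycles (U ∖ cycleOf x) k) (representatives (k ℕ.≟ period x)))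
    where
    rep-on-cycle? : Decidable (λ i → IsCycleRep π k i × OnCycle x i)
    rep-on-cycle? i = isCycleRep? π k i ×-dec onCycle? x i
    representatives : Dec (k ≡ period x) → count rep-on-cycle? (allFin n) ≡ indicator (ℕ._≟ period x) k
    representatives (yes refl) =
      trans (count-unique (allFin-isEnumeration n) rep-on-cycle? (proj₁ (leastOnCycle x))
                          (cycleRep-least x , proj₁ (proj₂ (leastOnCycle x))) (λ y (rep , c) → cycleRep-unique x c rep))
            (sym (indicator-yes (ℕ._≟ period x) refl))
    representatives (no k≢px) =
      trans (count-none rep-on-cycle? (allFin n) (λ y (rep , c) → k≢px (trans (cycleRep-period k>0 rep) (period-onCycle c))))
            (sym (indicator-no (ℕ._≟ period x) k≢px))

  count-period : ∀ U → Closed U → ∀ k → 0 < k → countIn U (λ v → period v ℕ.≟ k) ≡ k * cycles U k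
  count-period U closed k k>0 = closed-induction (λ U → countIn U (λ v → period v ℕ.≟ k) ≡ k * cycles U k) step U closed
    where
    step : ∀ U → Closed U → (∀ V → Closed V → size V < size U → countIn V (λ v → period v ℕ.≟ k) ≡ k * cycles V k) →
           countIn U (λ v → period v ℕ.≟ k) ≡ k * cycles U k
    step U closed IH with any? (λ i → T? (U i))
    ... | no ¬∃ = trans (countIn-empty empty (λ v → period v ℕ.≟ k))
                       (sym (trans (cong (k *_) (countIn-empty empty (isCycleRep? π k))) (*-zeroʳ k)))
      where
      empty : ∀ i → i ∉ U
      empty i i∈U = ¬∃ (i , i∈U)
    ... | yes (x , x∈U) = begin
      countIn U (λ v → period v ℕ.≟ k)
        ≡⟨ countIn-∖-cycleOf closed x∈U (λ v → period v ℕ.≟ k) ⟩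
      count period-on-cycle? (allFin n) + countIn (U ∖ cycleOf x) (λ v → period v ℕ.≟ k)
        ≡⟨ cong₂ _+_ (on-cycle (k ℕ.≟ period x)) (IH _ (closed-∖ closed (closed-cycleOf x)) (size-∖-cycleOf closed x∈U)) ⟩
      k * indicator (ℕ._≟ period x) k + k * cycles (U ∖ cycleOf x) k
        ≡⟨ sym (*-distribˡ-+ k _ _) ⟩
      k * (indicator (ℕ._≟ period x) k + cycles (U ∖ cycleOf x) k)
        ≡⟨ cong (k *_) (sym (cycles-∖-cycleOf closed x∈U k>0)) ⟩
      k * cycles U k ∎
      where
      period-on-cycle? : Decidable (λ v → period v ≡ k × OnCycle x v)
      period-on-cycle? v = (period v ℕ.≟ k) ×-dec onCycle? x v
      on-cycle : Dec (k ≡ period x) → count period-on-cycle? (allFin n) ≡ k * indicator (ℕ._≟ period x) k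
      on-cycle (yes refl) =
        trans (count-cong period-on-cycle? (onCycle? x) (allFin n) (λ _ → proj₂) (λ _ c → period-onCycle c , c))
              (trans (count-onCycle x) (sym (trans (cong (period x *_) (indicator-yes (ℕ._≟ period x) refl)) (*-identityʳ _))))
      on-cycle (no k≢px) =
        trans (count-none period-on-cycle? (allFin n) (λ _ (e , c) → k≢px (trans (sym e) (period-onCycle c))))
              (sym (trans (cong (k *_) (indicator-no (ℕ._≟ period x) k≢px)) (*-zeroʳ k)))

  cycles-cong : ∀ {U V} → (∀ i → i ∈ U → i ∈ V) → (∀ i → i ∈ V → i ∈ U) → ∀ k → cycles U k ≡ cycles V k
  cycles-cong {U} {V} U⊆V V⊆U k =
    count-cong (λ i → T? (U i) ×-dec isCycleRep? π k i) (λ i → T? (V i) ×-dec isCycleRep? π k i) (allFin n)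
               (λ i (i∈U , rep) → U⊆V i i∈U , rep) (λ i (i∈V , rep) → V⊆U i i∈V , rep)

  cycles-∖-same : ∀ {U} → Closed U → ∀ {x} → x ∈ U → cycles U (period x) ≡ suc (cycles (U ∖ cycleOf x) (period x))
  cycles-∖-same {U} closed {x} x∈U = trans (cycles-∖-cycleOf closed x∈U (period>0 x))
                                           (cong (_+ cycles (U ∖ cycleOf x) (period x)) (indicator-yes (ℕ._≟ period x) refl))

  cycles-∖-other : ∀ {U} → Closed U → ∀ {x} → x ∈ U → ∀ {j} → 0 < j → j ≢ period x →
                   cycles (U ∖ cycleOf x) j ≡ cycles U j
  cycles-∖-other {U} closed {x} x∈U {j} j>0 j≢px =
    sym (trans (cycles-∖-cycleOf closed x∈U j>0) (cong (_+ cycles (U ∖ cycleOf x) j) (indicator-no (ℕ._≟ period x) j≢px)))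

module Factorizations {n : ℕ} (π : Permutation′ n) where

  open import Data.Nat using (ℕ; suc; _+_; _*_; _∸_; _≤_; _<_; z≤n; s≤s; z<s)
  import Data.Nat.Properties as ℕ
  open import Data.Bool using (Bool; true)
  open import Data.Fin using (Fin)
  open import Data.Fin.Properties using (_≟_; any?)
  open import Data.Fin.Permutation using (Permutation′)
  open import Data.List using (List; allFin; map; filter; upTo; cartesianProduct)
  open import Data.List.Membership.Propositional using () renaming (_∈_ to _∈ₗ_)
  open import Data.List.Membership.Propositional.Properties using (∈-map⁺; ∈-map⁻; ∈-filter⁻; ∈-upTo⁺)
  open import Data.List.Relation.Unary.Unique.Propositional using (Unique)
  open import Data.List.Relation.Unary.Unique.Propositional.Properties using (map⁺; upTo⁺)
  open import Data.Nat.ListAction using (sum; product)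
  open import Data.Product using (_×_; _,_; proj₁; proj₂)
  open import Data.Unit using (tt)
  open import Function using (_∘_)
  open import Relation.Unary using (Decidable)
  open import Relation.Nullary using (Dec; yes; no; ¬_; contradiction)
  open import Relation.Nullary.Decidable using (_×-dec_; ¬?; T?)
  open import Relation.Binary.PropositionalEquality
  open Counting
  open Recurrence using (f-recurrence)
  open import Data.Nat.Tactic.RingSolver using (solve-∀)
  open Finite using (allFin-isEnumeration; allVecs; allVecs-isEnumeration; count-allFuns)
  open import Data.Vec using (lookup; tabulate)
  open import Data.Vec.Properties using (lookup∘tabulate; tabulate∘lookup; tabulate-cong)

  open Orbits π
  open Splittings π
  open CycleCounts π
  open ≡-Reasoning

  lengths : List ℕ
  lengths = map suc (upTo n)

  lengths-unique : Unique lengths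
  lengths-unique = map⁺ ℕ.suc-injective (upTo⁺ n)

  ∈-lengths⁺ : ∀ {k} → 0 < k → k ≤ n → k ∈ₗ lengths
  ∈-lengths⁺ (s≤s {n = k} z≤n) k≤n = ∈-map⁺ suc (∈-upTo⁺ k≤n)

  ∈-lengths⁻ : ∀ {k} → k ∈ₗ lengths → 0 < k
  ∈-lengths⁻ k∈ with ∈-map⁻ suc k∈
  ... | _ , _ , refl = z<s

  Fᵤ : (Fin n → Bool) → ℕ
  Fᵤ U = product (map (λ k → f (cycles U k) k) lengths)

  otherFactors : (Fin n → Bool) → ℕ → ℕ
  otherFactors U k = product (map (λ j → f (cycles U j) j) (filter (λ j → ¬? (j ℕ.≟ k)) lengths))

  Fᵤ-factor : ∀ U {k} → 0 < k → k ≤ n → Fᵤ U ≡ f (cycles U k) k * otherFactors U k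
  Fᵤ-factor U k>0 k≤n = product-factor lengths-unique (∈-lengths⁺ k>0 k≤n) (λ k → f (cycles U k) k)

  otherFactors-cong : ∀ U V k → (∀ j → 0 < j → j ≢ k → cycles V j ≡ cycles U j) → otherFactors V k ≡ otherFactors U k
  otherFactors-cong U V k agree = product-cong (filter (λ j → ¬? (j ℕ.≟ k)) lengths) λ j∈ →
    let j∈lengths , j≢k = ∈-filter⁻ (λ j → ¬? (j ℕ.≟ k)) j∈ in cong (λ c → f c _) (agree _ (∈-lengths⁻ j∈lengths) j≢k)

  Fᵤ-cong : ∀ U V → (∀ k → cycles U k ≡ cycles V k) → Fᵤ U ≡ Fᵤ V
  Fᵤ-cong U V agree = product-cong lengths (λ {k} _ → cong (λ c → f c k) (agree k))

  splittingCount : (Fin n → Bool) → ℕ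
  splittingCount U = count (λ w → splitting? U (lookup w)) (allVecs n n)

  private
    x≡x*1+y*0 : ∀ x y → x ≡ x * 1 + y * 0
    x≡x*1+y*0 = solve-∀

    y≡x*0+y*1 : ∀ x y → y ≡ x * 0 + y * 1
    y≡x*0+y*1 = solve-∀

    0≡x*0+y*0 : ∀ x y → 0 ≡ x * 0 + y * 0
    0≡x*0+y*0 = solve-∀

  module InductionStep {U} (closed : Closed U) {u} (u∈U : u ∈ U)
              (IH : ∀ V → Closed V → size V < size U → splittingCount V ≡ Fᵤ V) where

    k c : ℕ
    k = period u
    c = cycles U k

    V : Fin n → Bool
    V = U ∖ cycleOf u

    closed-V : Closed V
    closed-V = closed-∖ closed (closed-cycleOf u)

    c≡1+cycles-V : c ≡ suc (cycles V k)
    c≡1+cycles-V = cycles-∖-same closed u∈U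

    cycles-V-other : ∀ j → 0 < j → j ≢ k → cycles V j ≡ cycles U j
    cycles-V-other j j>0 = cycles-∖-other closed u∈U j>0

    rest : ℕ
    rest = otherFactors U k

    Fᵤ-V : Fᵤ V ≡ f (c ∸ 1) k * rest
    Fᵤ-V = trans (Fᵤ-factor V (period>0 u) (period≤n u))
                 (cong₂ (λ a b → f a k * b) (cong (_∸ 1) (sym c≡1+cycles-V)) (otherFactors-cong U V k cycles-V-other))

    Fᵤ-V∖v : ∀ {v} → v ∈ V → period v ≡ k → Fᵤ (V ∖ cycleOf v) ≡ f (c ∸ 2) k * rest
    Fᵤ-V∖v {v} v∈V pv≡k = trans (Fᵤ-factor W (period>0 u) (period≤n u))
                                (cong₂ (λ a b → f a k * b) cycles-W-k (otherFactors-cong U W k cycles-W-other))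
      where
      W : Fin n → Bool
      W = V ∖ cycleOf v
      cycles-W-k : cycles W k ≡ c ∸ 2
      cycles-W-k = cong (_∸ 2) (sym (trans c≡1+cycles-V
                     (cong suc (subst (λ k → cycles V k ≡ suc (cycles W k)) pv≡k (cycles-∖-same closed-V v∈V)))))
      cycles-W-other : ∀ j → 0 < j → j ≢ k → cycles W j ≡ cycles U j
      cycles-W-other j j>0 j≢k = trans (cycles-∖-other closed-V v∈V j>0 (λ j≡pv → j≢k (trans j≡pv pv≡k))) (cycles-V-other j j>0 j≢k)

    G₂ : ℕ
    G₂ = f (c ∸ 2) k * rest

    -- The possible values of σ u outside the cycle of u.
    Image? : Decidable (λ v → v ∈ V × period v ≡ k)
    Image? v = T? (V v) ×-dec (period v ℕ.≟ k)

    sendingCount : Fin n → ℕ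
    sendingCount v = count (λ w → splitting? U (lookup w) ×-dec (lookup w u ≟ v)) (allVecs n n)

    sendingCount-pair : ∀ {v} → v ∈ U → period v ≡ k → sendingCount v ≡ Fᵤ (V ∖ cycleOf v)
    sendingCount-pair {v} v∈U pv≡k =
      trans (Pairing.count-splittings-pair closed u∈U v∈U pv≡k)
            (IH (V ∖ cycleOf v) (Pairing.closed-W closed u∈U v∈U pv≡k)
                (ℕ.≤-<-trans (size-∖ V (cycleOf v)) (size-∖-cycleOf closed u∈U)))

    sendingCount-same-cycle : ∀ {v} → OnCycle u v → sendingCount v ≡ Fᵤ V
    sendingCount-same-cycle {v} cuv =
      trans (sendingCount-pair (closed-onCycle closed u∈U cuv) (period-onCycle cuv))
            (Fᵤ-cong (V ∖ cycleOf v) V (cycles-cong (λ i → proj₁ ∘ ∈-∖⁻ {V} {cycleOf v}) V⊆V∖Cv))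
      where
      V⊆V∖Cv : ∀ i → i ∈ V → i ∈ V ∖ cycleOf v
      V⊆V∖Cv i i∈V = ∈-∖⁺ {V} {cycleOf v} i∈V λ i∈Cv →
        proj₂ (∈-∖⁻ {U} {cycleOf u} i∈V) (∈cycleOf⁺ (onCycle-trans cuv (∈cycleOf⁻ i∈Cv)))

    sendingCount-other-cycle : ∀ {v} → v ∈ V → period v ≡ k → sendingCount v ≡ G₂
    sendingCount-other-cycle v∈V pv≡k = trans (sendingCount-pair (proj₁ (∈-∖⁻ {U} {cycleOf u} v∈V)) pv≡k) (Fᵤ-V∖v v∈V pv≡k)

    sendingCount-none : ∀ {v} → ¬ (v ∈ U × period v ≡ k) → sendingCount v ≡ 0
    sendingCount-none {v} ¬image = count-none (λ w → splitting? U (lookup w) ×-dec (lookup w u ≟ v)) (allVecs n n) λ { w (s , refl) →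
      ¬image (SplittingProperties.preserves closed s u∈U , SplittingProperties.period-σ closed s u∈U) }

    sendingCount≡ : ∀ v → sendingCount v ≡ Fᵤ V * indicator (onCycle? u) v + G₂ * indicator Image? v
    sendingCount≡ v = by-cases (onCycle? u v) (Image? v)
      where
      combine : ∀ {a b} → indicator (onCycle? u) v ≡ a → indicator Image? v ≡ b →
                Fᵤ V * a + G₂ * b ≡ Fᵤ V * indicator (onCycle? u) v + G₂ * indicator Image? v
      combine ind₁≡a ind₂≡b = sym (cong₂ (λ a b → Fᵤ V * a + G₂ * b) ind₁≡a ind₂≡b)
      by-cases : Dec (OnCycle u v) → Dec (v ∈ V × period v ≡ k) →
                 sendingCount v ≡ Fᵤ V * indicator (onCycle? u) v + G₂ * indicator Image? v
      by-cases (yes cuv) _ = trans (sendingCount-same-cycle cuv)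
        (trans (x≡x*1+y*0 (Fᵤ V) G₂) (combine (indicator-yes (onCycle? u) cuv)
                                              (indicator-no Image? (λ (v∈V , _) → proj₂ (∈-∖⁻ {U} {cycleOf u} v∈V) (∈cycleOf⁺ cuv)))))
      by-cases (no ¬cuv) (yes (v∈V , pv≡k)) = trans (sendingCount-other-cycle v∈V pv≡k)
        (trans (y≡x*0+y*1 (Fᵤ V) G₂) (combine (indicator-no (onCycle? u) ¬cuv) (indicator-yes Image? (v∈V , pv≡k))))
      by-cases (no ¬cuv) (no ¬image) = trans (sendingCount-none ¬image′)
        (trans (0≡x*0+y*0 (Fᵤ V) G₂) (combine (indicator-no (onCycle? u) ¬cuv) (indicator-no Image? ¬image)))
        where
        ¬image′ : ¬ (v ∈ U × period v ≡ k)
        ¬image′ (v∈U , pv≡k) = ¬image (∈-∖⁺ {U} {cycleOf u} v∈U (¬cuv ∘ ∈cycleOf⁻) , pv≡k)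

    -- Sending u into its own cycle leaves a splitting of V; sending it to one of the (c − 1)k points on
    -- another k-cycle leaves one of V without that cycle. This is the recurrence of f.
    splittingCount-step : splittingCount U ≡ Fᵤ U
    splittingCount-step = begin
      splittingCount U
        ≡⟨ count-fibres (allFin-isEnumeration n) (λ w → splitting? U (lookup w)) (λ w → lookup w u) (allVecs n n) ⟩
      sum (map sendingCount (allFin n))
        ≡⟨ sum-map-cong (allFin n) sendingCount≡ ⟩
      sum (map (λ v → Fᵤ V * ind₁ v + G₂ * ind₂ v) (allFin n))
        ≡⟨ trans (sum-map-+ (allFin n) _ _) (cong₂ _+_ (sum-map-* (allFin n) (Fᵤ V) ind₁) (sum-map-* (allFin n) G₂ ind₂)) ⟩
      Fᵤ V * count (onCycle? u) (allFin n) + G₂ * countIn V (λ v → period v ℕ.≟ k)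
        ≡⟨ cong₂ (λ a b → Fᵤ V * a + G₂ * b) (count-onCycle u) (count-period V closed-V k (period>0 u)) ⟩
      Fᵤ V * k + G₂ * (k * cycles V k)
        ≡⟨ cong₂ (λ a b → a * k + G₂ * (k * b)) Fᵤ-V (cong (_∸ 1) (sym c≡1+cycles-V)) ⟩
      f (c ∸ 1) k * rest * k + f (c ∸ 2) k * rest * (k * (c ∸ 1))
        ≡⟨ rearrange (f (c ∸ 1) k) (f (c ∸ 2) k) rest k (c ∸ 1) ⟩
      (k * f (c ∸ 1) k + (c ∸ 1) * k * f (c ∸ 2) k) * rest
        ≡⟨ cong (_* rest) (sym (f-recurrence k c (subst (0 <_) (sym c≡1+cycles-V) z<s))) ⟩
      f c k * rest
        ≡⟨ sym (Fᵤ-factor U (period>0 u) (period≤n u)) ⟩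
      Fᵤ U ∎
      where
      ind₁ ind₂ : Fin n → ℕ
      ind₁ = indicator (onCycle? u)
      ind₂ = indicator Image?
      rearrange : ∀ a b r k d → a * r * k + b * r * (k * d) ≡ (k * a + d * k * b) * r
      rearrange = solve-∀

  splittingCount-empty : ∀ {U} → (∀ i → i ∉ U) → splittingCount U ≡ 1
  splittingCount-empty {U} empty =
    count-unique (allVecs-isEnumeration n n) (λ w → splitting? U (lookup w)) (tabulate (λ i → i))
                 (splitting-resp (λ i → sym (lookup∘tabulate (λ i → i) i)) identity)
                 (λ w s → trans (sym (tabulate∘lookup w)) (tabulate-cong (λ i → proj₁ (s i) (empty i))))
    where
    identity : Splitting U (λ i → i)
    identity i = (λ _ → refl) , refl , (λ i∈U → contradiction i∈U (empty i))

  Fᵤ-empty : ∀ {U} → (∀ i → i ∉ U) → Fᵤ U ≡ 1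
  Fᵤ-empty {U} empty = product-map-≡1 lengths (λ k → cong (λ c → f c k) (countIn-empty empty (isCycleRep? π k)))

  splittingCount≡Fᵤ : ∀ U → Closed U → splittingCount U ≡ Fᵤ U
  splittingCount≡Fᵤ = closed-induction (λ U → splittingCount U ≡ Fᵤ U) step
    where
    step : ∀ U → Closed U → (∀ V → Closed V → size V < size U → splittingCount V ≡ Fᵤ V) → splittingCount U ≡ Fᵤ U
    step U closed IH with any? (λ i → T? (U i))
    ... | yes (u , u∈U) = InductionStep.splittingCount-step closed u∈U IH
    ... | no ¬∃         = trans (splittingCount-empty empty) (sym (Fᵤ-empty empty))
      where
      empty : ∀ i → i ∉ U
      empty i i∈U = ¬∃ (i , i∈U)

  whole : Fin n → Bool
  whole _ = true

  closed-whole : Closed whole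
  closed-whole = p-invariant (λ _ → refl)

  invFactorization⇒splitting : ∀ {σ τ} → IsInvFactorization π (σ , τ) → Splitting whole σ
  invFactorization⇒splitting {σ} {τ} (σ-inv , τ-inv , π≡τσ) i = (λ i∉ → contradiction tt i∉) , σ-inv i , λ _ → begin
    p (σ (p (σ i)))           ≡⟨ cong (λ z → p (σ z)) (π≡τσ (σ i)) ⟩
    p (σ (τ (σ (σ i))))       ≡⟨ cong (λ z → p (σ (τ z))) (σ-inv i) ⟩
    p (σ (τ i))               ≡⟨ π≡τσ (σ (τ i)) ⟩
    τ (σ (σ (τ i)))           ≡⟨ cong τ (σ-inv (τ i)) ⟩
    τ (τ i)                   ≡⟨ τ-inv i ⟩
    i ∎

  splitting⇒invFactorization : ∀ {σ} → Splitting whole σ → IsInvFactorization π (σ , λ i → p (σ i))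
  splitting⇒invFactorization {σ} s =
    (λ i → proj₁ (proj₂ (s i))) , (λ i → proj₂ (proj₂ (s i)) tt) , (λ i → cong p (sym (proj₁ (proj₂ (s i)))))

  invFactorization-τ : ∀ {σ τ} → IsInvFactorization π (σ , τ) → ∀ i → τ i ≡ p (σ i)
  invFactorization-τ {σ} {τ} (σ-inv , _ , π≡τσ) i = trans (cong τ (sym (σ-inv i))) (sym (π≡τσ (σ i)))

  -- A factorization π = τ ∘ σ into involutions is determined by σ, via τ = π ∘ σ.
  numInvFactorizations≡splittingCount : numInvFactorizations π ≡ splittingCount whole
  numInvFactorizations≡splittingCount = begin
    numInvFactorizations π
      ≡⟨ length-filter (isInvFactorization? π) (cartesianProduct (allFuns n n) (allFuns n n)) ⟩
    count (isInvFactorization? π) (cartesianProduct (allFuns n n) (allFuns n n))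
      ≡⟨ count-cartesianProduct (isInvFactorization? π) (allFuns n n) (allFuns n n) ⟩
    sum (map (λ σ → count (λ τ → isInvFactorization? π (σ , τ)) (allFuns n n)) (allFuns n n))
      ≡⟨ sum-map-cong (allFuns n n) partners ⟩
    count (splitting? whole) (allFuns n n)
      ≡⟨ count-allFuns (splitting? whole) (λ σ σ′ σ≗σ′ → splitting-resp σ≗σ′) ⟩
    splittingCount whole ∎
    where
    partners : ∀ σ → count (λ τ → isInvFactorization? π (σ , τ)) (allFuns n n) ≡ indicator (splitting? whole) σ
    partners σ = trans (count-allFuns (λ τ → isInvFactorization? π (σ , τ)) respects) (unique-partner (splitting? whole σ))
      where
      respects : ∀ τ τ′ → τ ≗ τ′ → IsInvFactorization π (σ , τ) → IsInvFactorization π (σ , τ′)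
      respects τ τ′ τ≗τ′ (σ-inv , τ-inv , π≡τσ) =
        σ-inv , (λ i → trans (cong τ′ (sym (τ≗τ′ i))) (trans (sym (τ≗τ′ (τ i))) (τ-inv i))) , (λ i → trans (π≡τσ i) (τ≗τ′ (σ i)))
      unique-partner : Dec (Splitting whole σ) →
                       count (λ w → isInvFactorization? π (σ , lookup w)) (allVecs n n) ≡ indicator (splitting? whole) σ
      unique-partner (yes s) = trans (count-unique (allVecs-isEnumeration n n) (λ w → isInvFactorization? π (σ , lookup w))
                                                   (tabulate (λ i → p (σ i)))
                                                   (respects _ _ (λ i → sym (lookup∘tabulate _ i)) (splitting⇒invFactorization s))
                                                   (λ w fac → trans (sym (tabulate∘lookup w)) (tabulate-cong (invFactorization-τ fac))))
                                     (sym (indicator-yes (splitting? whole) s))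
      unique-partner (no ¬s) = trans (count-none (λ w → isInvFactorization? π (σ , lookup w)) (allVecs n n)
                                                 (λ w → ¬s ∘ invFactorization⇒splitting {τ = lookup w}))
                                     (sym (indicator-no (splitting? whole) ¬s))

  Fᵤ-whole : Fᵤ whole ≡ F π
  Fᵤ-whole = product-cong lengths (λ {k} _ → cong (λ c → f c k) (cycles-whole k))
    where
    cycles-whole : ∀ k → cycles whole k ≡ cycleCount π k
    cycles-whole k = trans (count-cong (λ i → T? true ×-dec isCycleRep? π k i) (isCycleRep? π k) (allFin n)
                                       (λ _ → proj₂) (λ _ rep → tt , rep))
                           (sym (length-filter (isCycleRep? π k) (allFin n)))

mainTheorem16 : (n : ℕ) (π : Permutation′ n) → numInvFactorizations π ≡ F π
mainTheorem16 n π = begin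
  numInvFactorizations π   ≡⟨ numInvFactorizations≡splittingCount ⟩
  splittingCount whole     ≡⟨ splittingCount≡Fᵤ whole closed-whole ⟩
  Fᵤ whole                 ≡⟨ Fᵤ-whole ⟩
  F π ∎
  where
  open Factorizations π
  open ≡-Reasoning
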